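{- Let $m\ge1$ and let $p=[\sigma_1,\ldots,\sigma_m]$ be a disjoint chains partially ordered pattern of length $2m$ in which every chain $\sigma_i$ has exactly two elements. Let $C(x)$ be the exponential generating function for the number of permutations avoiding $p$. Then $$C(x)=\frac{1-\bigl(1+(x-1)e^x\bigr)^m}{1-x}.$$
   Context: A partially ordered pattern (POP) of length $k$ is a poset on $[k]$; an occurrence of it in a permutation $\pi=\pi_1\cdots\pi_n$ is a subsequence $\pi_{i_1}\cdots\pi_{i_k}$ with $i_1<\cdots<i_k$ such that $\pi_{i_j}<\pi_{i_m}$ whenever $j<m$ in the poset; avoidance means having no occurrence. A disjoint chains POP $[\sigma_1,\ldots,\sigma_m]$ of length $k=\sum_i k_i$ is the POP whose poset is a disjoint union of $m$ chains, where $\sigma_i$ is a permutation (a sequence) of the set $\{1+\sum_{j<i}k_j,\ldots,\sum_{j\le i}k_j\}$ and the $i$-th chain, read from top to bottom, is $\sigma_i$ (so the first entry of $\sigma_i$ is the largest element of the chain); elements of different chains are incomparable. The exponential generating function of $c(n)$ is $\sum_{n\ge0}c(n)x^n/n!$. -}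

module Defs where

open import Data.Nat using (ℕ; zero; suc; _+_; _*_; _∸_; _<_; _!)
open import Data.Nat.Properties using (_!≢0)
open import Data.Fin using (Fin; toℕ)
open import Data.Vec using (Vec; lookup)
open import Data.List using (List; []; _∷_; _++_; upTo; map; foldr)
open import Data.Product using (Σ; ∃; _×_; _,_)
open import Data.Sum using (_⊎_)
open import Data.Integer using (+_)
open import Data.Rational using (ℚ; 0ℚ; 1ℚ; _/_) renaming (_+_ to _+ℚ_; _*_ to _*ℚ_; _-_ to _-ℚ_)
open import Data.Refinement using (Refinement-syntax)
open import Relation.Nullary using (¬_)
open import Relation.Binary.PropositionalEquality using (_≡_)

IsPerm : ∀ {n} → Vec (Fin n) n → Set
IsPerm {n} π = ∀ (i j : Fin n) → lookup π i ≡ lookup π j → i ≡ j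

-- Disjoint chains POP [σ_1,…,σ_m] given by its chains (each chain a list of
-- elements of {1,…,k}, read from top to bottom, i.e. the first entry is the
-- largest).  a <_P b  iff  a and b lie in a common chain and b comes before a.

DCLess : ∀ {m} → Vec (List ℕ) m → ℕ → ℕ → Set
DCLess {m} chains a b =
  Σ (Fin m) λ i → Σ (List ℕ) λ xs → Σ (List ℕ) λ ys → Σ (List ℕ) λ zs →
    lookup chains i ≡ xs ++ (b ∷ ys ++ (a ∷ zs))

-- Poset relation on positions Fin k of the pattern (position j ↔ element j+1).
PopLess : ∀ {m} → Vec (List ℕ) m → ∀ {k} → Fin k → Fin k → Set
PopLess chains j l = DCLess chains (suc (toℕ j)) (suc (toℕ l))

Occurs : ∀ {k} → (Fin k → Fin k → Set) → ∀ {n} → Vec (Fin n) n → Set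
Occurs {k} less {n} π =
  Σ (Fin k → Fin n) λ f →
    (∀ j l → toℕ j < toℕ l → toℕ (f j) < toℕ (f l)) ×
    (∀ j l → less j l → toℕ (lookup π (f j)) < toℕ (lookup π (f l)))

Avoids : ∀ {k} → (Fin k → Fin k → Set) → ∀ {n} → Vec (Fin n) n → Set
Avoids less π = ¬ Occurs less π

-- The set of permutations of [n] avoiding the POP (proof-irrelevant subset,
-- so that elements are determined by their one-line notation).
Avoiders : ∀ {k} → (Fin k → Fin k → Set) → ℕ → Set
Avoiders less n = [ π ∈ Vec (Fin n) n ∣ IsPerm π × Avoids less π ]

Series : Set
Series = ℕ → ℚ

sumℚ : List ℚ → ℚ
sumℚ = foldr _+ℚ_ 0ℚ

_⊕_ : Series → Series → Series
(f ⊕ g) n = f n +ℚ g n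

_⊖_ : Series → Series → Series
(f ⊖ g) n = f n -ℚ g n

_⊛_ : Series → Series → Series
(f ⊛ g) n = sumℚ (map (λ i → f i *ℚ g (n ∸ i)) (upTo (suc n)))

infixl 6 _⊕_ _⊖_
infixl 7 _⊛_

oneS : Series
oneS zero = 1ℚ
oneS (suc _) = 0ℚ

xS : Series
xS (suc zero) = 1ℚ
xS _ = 0ℚ

_^S_ : Series → ℕ → Series
f ^S zero = oneS
f ^S suc k = f ⊛ (f ^S k)

expS : Series
expS n = (+ 1 / (n !)) {{n !≢0}}

EGF : (ℕ → ℕ) → Series
EGF c n = (+ (c n) / (n !)) {{n !≢0}}

{-# OPTIONS --safe #-}
module Submission where

-- A permutation contains [σ₁,…,σₘ] iff a greedy left-to-right scan finds a pair of letters ordered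
-- like σ₁, then further right one ordered like σ₂, and so on: the scan keeps a candidate x for the
-- first entry of the current pair and replaces it by the next letter y whenever x, y are in the
-- wrong order, since every letter closing a pair with x then closes one with y.  Splitting the
-- permutations on which the scan fails by their first letter gives a recursion whose solution does
-- not depend on the orientations: the numbers aᵣ(n) of avoiders of r pairs satisfy a₀ = 0 and
--   aᵣ₊₁(n) = 1 + Σ_{j<n} j·C(n, j+1)·aᵣ(n−j−1).
-- For the exponential generating functions this reads Aᵣ₊₁ = eˣ + B·Aᵣ with B = 1 + (x−1)eˣ, and
-- since (1−x)eˣ + B = 1, induction on r gives (1−x)Aᵣ = 1 − Bʳ.

open import Algebra.Bundles using (CommutativeMonoid)

module FiniteSum {c ℓ} (M : CommutativeMonoid c ℓ) where

  open import Data.Nat.Base using (ℕ; zero; suc; _<_; s≤s; z≤n)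
  open import Data.Nat.Properties using (suc-injective)
  open import Function.Base using (_∘_)
  open import Relation.Binary.PropositionalEquality.Core using (_≢_)
  open CommutativeMonoid M
  open import Algebra.Properties.CommutativeSemigroup commutativeSemigroup
    using (interchange; xy∙z≈xz∙y)
  open import Relation.Binary.Reasoning.Setoid setoid

  ∑< : ℕ → (ℕ → Carrier) → Carrier
  ∑< zero    f = ε
  ∑< (suc k) f = f 0 ∙ ∑< k (f ∘ suc)

  ∑<-cong : ∀ k {f g : ℕ → Carrier} → (∀ i → i < k → f i ≈ g i) → ∑< k f ≈ ∑< k g
  ∑<-cong zero    f≈g = refl
  ∑<-cong (suc k) f≈g = ∙-cong (f≈g 0 (s≤s z≤n)) (∑<-cong k (λ i i<k → f≈g (suc i) (s≤s i<k)))

  ∑<-zero : ∀ k {f : ℕ → Carrier} → (∀ i → i < k → f i ≈ ε) → ∑< k f ≈ ε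
  ∑<-zero zero    f≈ε = refl
  ∑<-zero (suc k) f≈ε =
    trans (∙-cong (f≈ε 0 (s≤s z≤n)) (∑<-zero k (λ i i<k → f≈ε (suc i) (s≤s i<k)))) (identityˡ ε)

  ∑<-distrib : ∀ k (f g : ℕ → Carrier) → ∑< k (λ i → f i ∙ g i) ≈ ∑< k f ∙ ∑< k g
  ∑<-distrib zero    f g = sym (identityˡ ε)
  ∑<-distrib (suc k) f g = begin
    (f 0 ∙ g 0) ∙ ∑< k (λ i → f (suc i) ∙ g (suc i))  ≈⟨ ∙-congˡ (∑<-distrib k (f ∘ suc) (g ∘ suc)) ⟩
    (f 0 ∙ g 0) ∙ (∑< k (f ∘ suc) ∙ ∑< k (g ∘ suc))   ≈⟨ interchange (f 0) (g 0) _ _ ⟩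
    ∑< (suc k) f ∙ ∑< (suc k) g                       ∎

  ∑<-last : ∀ k (f : ℕ → Carrier) → ∑< (suc k) f ≈ ∑< k f ∙ f k
  ∑<-last zero    f = trans (identityʳ (f 0)) (sym (identityˡ (f 0)))
  ∑<-last (suc k) f = trans (∙-congˡ (∑<-last k (f ∘ suc))) (sym (assoc (f 0) _ (f (suc k))))

  ∑<-exchange : ∀ k i (f g : ℕ → Carrier) → i < k → (∀ j → j < k → j ≢ i → f j ≈ g j) →
                ∑< k f ∙ g i ≈ ∑< k g ∙ f i
  ∑<-exchange (suc k) zero f g _ f≈g = begin
    (f 0 ∙ ∑< k (f ∘ suc)) ∙ g 0  ≈⟨ ∙-congʳ (∙-congˡ (∑<-cong k (λ j j<k → f≈g (suc j) (s≤s j<k) λ ()))) ⟩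
    (f 0 ∙ ∑< k (g ∘ suc)) ∙ g 0  ≈⟨ xy∙z≈xz∙y (f 0) _ (g 0) ⟩
    (f 0 ∙ g 0) ∙ ∑< k (g ∘ suc)  ≈⟨ ∙-congʳ (comm (f 0) (g 0)) ⟩
    (g 0 ∙ f 0) ∙ ∑< k (g ∘ suc)  ≈⟨ xy∙z≈xz∙y (g 0) (f 0) _ ⟩
    ∑< (suc k) g ∙ f 0            ∎
  ∑<-exchange (suc k) (suc i) f g (s≤s i<k) f≈g = begin
    (f 0 ∙ ∑< k (f ∘ suc)) ∙ g (suc i)  ≈⟨ assoc (f 0) _ _ ⟩
    f 0 ∙ (∑< k (f ∘ suc) ∙ g (suc i))  ≈⟨ ∙-cong (f≈g 0 (s≤s z≤n) λ ()) (∑<-exchange k i (f ∘ suc) (g ∘ suc) i<k f≈g′) ⟩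
    g 0 ∙ (∑< k (g ∘ suc) ∙ f (suc i))  ≈⟨ assoc (g 0) _ _ ⟨
    ∑< (suc k) g ∙ f (suc i)            ∎
    where
    f≈g′ : ∀ j → j < k → j ≢ i → f (suc j) ≈ g (suc j)
    f≈g′ j j<k j≢i = f≈g (suc j) (s≤s j<k) (j≢i ∘ suc-injective)

module _ {c₁ ℓ₁ c₂ ℓ₂} {M : CommutativeMonoid c₁ ℓ₁} {N : CommutativeMonoid c₂ ℓ₂} where

  open import Data.Nat.Base using (zero; suc)
  open import Function.Base using (_∘_)

  private
    module M = CommutativeMonoid M
    module N = CommutativeMonoid N
    module ∑M = FiniteSum M
    module ∑N = FiniteSum N

  ∑<-homo : (h : M.Carrier → N.Carrier) → h M.ε N.≈ N.ε → (∀ x y → h (x M.∙ y) N.≈ h x N.∙ h y) →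
            ∀ k f → h (∑M.∑< k f) N.≈ ∑N.∑< k (h ∘ f)
  ∑<-homo h ε-homo homo zero    f = ε-homo
  ∑<-homo h ε-homo homo (suc k) f = N.trans (homo (f 0) _) (N.∙-congˡ (∑<-homo h ε-homo homo k (f ∘ suc)))

module Counting where

  open import Data.Bool.Base using (Bool; true; false; if_then_else_)
  open import Data.Bool.Properties using (if-cong)
  open import Data.Fin.Base using (Fin; zero; suc)
  open import Data.Nat.Base
  open import Data.Nat.Properties
  open import Data.Nat.Combinatorics using (_C_; nCn≡1; nCk+nC[k+1]≡[n+1]C[k+1])
  open import Data.Nat.Tactic.RingSolver using (solve-∀)
  open import Function.Base using (_∘_)
  open import Function.Bundles using (mk⇔)
  open import Relation.Binary.PropositionalEquality
  open import Relation.Nullary.Decidable using (dec-true; dec-false; does-⇔)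

  open FiniteSum +-0-commutativeMonoid
  open ≡-Reasoning

  ∑<-const : ∀ k c → ∑< k (λ _ → c) ≡ k * c
  ∑<-const zero    c = refl
  ∑<-const (suc k) c = cong (c +_) (∑<-const k c)

  ≤ᵇ-refl : ∀ n → (n ≤ᵇ n) ≡ true
  ≤ᵇ-refl n = dec-true (n ≤? n) ≤-refl

  <ᵇ-irrefl : ∀ n → (n <ᵇ n) ≡ false
  <ᵇ-irrefl n = dec-false (n <? n) (<-irrefl refl)

  <ᵇ≡≤ᵇ : ∀ {m n} → m ≢ n → (m <ᵇ n) ≡ (m ≤ᵇ n)
  <ᵇ≡≤ᵇ {m} {n} m≢n = does-⇔ (mk⇔ <⇒≤ (λ m≤n → ≤∧≢⇒< m≤n m≢n)) (m <? n) (m ≤? n)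

  -- Φ A t n counts the permutations of {0,…,n} that begin with t and avoid the pattern, when the
  -- first pair is increasing and A counts avoiders of the other pairs: t is followed by j letters
  -- decreasing from t and then by the letter closing the pair, which is either above t, or below t
  -- and above the last of the j letters; the first summand is the case of no closing letter.
  Φ : (ℕ → ℕ) → ℕ → ℕ → ℕ
  Φ A t n = t C n + ∑< n (λ j → ((n ∸ t) * (t C j) + j * (t C suc j)) * A (n ∸ suc j))

  Φ-cong : ∀ {A B : ℕ → ℕ} → (∀ i → A i ≡ B i) → ∀ t n → Φ A t n ≡ Φ B t n
  Φ-cong A≗B t n = cong (t C n +_)
    (∑<-cong n (λ j _ → cong (((n ∸ t) * (t C j) + j * (t C suc j)) *_) (A≗B (n ∸ suc j))))

  Φ-zero : ∀ A n → Φ A 0 (suc n) ≡ suc n * A n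
  Φ-zero A n = begin
      (suc n * 1 + 0) * A n + ∑< n (λ j → (suc n * 0 + suc j * 0) * A (n ∸ suc j))
    ≡⟨ cong ((suc n * 1 + 0) * A n +_) (∑<-zero n vanish) ⟩
      (suc n * 1 + 0) * A n + 0
    ≡⟨ simplify (suc n) (A n) ⟩
      suc n * A n
    ∎
    where
    vanish : ∀ j → j < n → (suc n * 0 + suc j * 0) * A (n ∸ suc j) ≡ 0
    vanish j _ = cong (_* A (n ∸ suc j)) (cong₂ _+_ (*-zeroʳ (suc n)) (*-zeroʳ (suc j)))
    simplify : ∀ m a → (m * 1 + 0) * a + 0 ≡ m * a
    simplify = solve-∀

  Φ-step : ∀ A t n → t ≤ n → Φ A (suc t) (suc n) + A n ≡ Φ A t (suc n) + Φ A t n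
  Φ-step A t n t≤n = begin
      (suc t C suc n + ((d * 1 + 0) * A n + ∑< n next)) + A n
    ≡⟨ cong₂ (λ c s → (c + ((d * 1 + 0) * A n + s)) + A n) (sym (nCk+nC[k+1]≡[n+1]C[k+1] t n)) next-split ⟩
      ((t C n + t C suc n) + ((d * 1 + 0) * A n + (S₁ (suc d) + S₀))) + A n
    ≡⟨ rearrange (t C n) (t C suc n) d (A n) (S₁ (suc d)) S₀ ⟩
      (t C suc n + ((suc d * 1 + 0) * A n + S₁ (suc d))) + (t C n + S₀)
    ≡⟨ cong (λ e → (t C suc n + ((e * 1 + 0) * A n + S₁ e)) + (t C n + S₀)) (sym (+-∸-assoc 1 t≤n)) ⟩
      Φ A t (suc n) + Φ A t n
    ∎
    where
    d = n ∸ t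
    X : ℕ → ℕ
    X j = A (n ∸ suc j)
    next : ℕ → ℕ
    next j = (d * (suc t C suc j) + suc j * (suc t C suc (suc j))) * X j
    S₀ : ℕ
    S₀ = ∑< n (λ j → (d * (t C j) + j * (t C suc j)) * X j)
    S₁ : ℕ → ℕ
    S₁ e = ∑< n (λ j → (e * (t C suc j) + suc j * (t C suc (suc j))) * X j)
    pascal : ∀ j → next j ≡ (suc d * (t C suc j) + suc j * (t C suc (suc j))) * X j
                             + (d * (t C j) + j * (t C suc j)) * X j
    pascal j rewrite sym (nCk+nC[k+1]≡[n+1]C[k+1] t j) | sym (nCk+nC[k+1]≡[n+1]C[k+1] t (suc j))
      = split d (t C j) (t C suc j) (t C suc (suc j)) j (X j)
      where
      split : ∀ d a b c j x → (d * (a + b) + suc j * (b + c)) * x ≡ (suc d * b + suc j * c) * x + (d * a + j * b) * x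
      split = solve-∀
    next-split : ∑< n next ≡ S₁ (suc d) + S₀
    next-split = trans (∑<-cong n (λ j _ → pascal j)) (∑<-distrib n _ _)
    rearrange : ∀ a b d x s₁ s₀ →
                ((a + b) + ((d * 1 + 0) * x + (s₁ + s₀))) + x ≡ (b + ((suc d * 1 + 0) * x + s₁)) + (a + s₀)
    rearrange = solve-∀

  Φ-diagonal : ∀ A n → Φ A n n ≡ 1 + ∑< n (λ j → j * (n C suc j) * A (n ∸ suc j))
  Φ-diagonal A n = cong₂ _+_ (nCn≡1 n)
    (∑<-cong n (λ j _ → cong (λ e → (e * (n C j) + j * (n C suc j)) * A (n ∸ suc j)) (n∸n≡0 n)))

  Φ-recurrence-asc : ∀ A (Y : ℕ → ℕ) n → (∀ b → b ≤ n → Y b ≡ Φ A b n) →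
    ∀ t → t ≤ suc n → ∑< (suc n) (λ b → if t ≤ᵇ b then A n else Y b) ≡ Φ A t (suc n)
  Φ-recurrence-asc A Y n Y≡Φ zero    _ = trans (∑<-const (suc n) (A n)) (sym (Φ-zero A n))
  Φ-recurrence-asc A Y n Y≡Φ (suc t) (s≤s t≤n) = +-cancelʳ-≡ _ _ _ (begin
      ∑< (suc n) f + A n        ≡⟨ cong (∑< (suc n) f +_) (if-cong {x = A n} {Y t} (≤ᵇ-refl t)) ⟨
      ∑< (suc n) f + g t        ≡⟨ ∑<-exchange (suc n) t f g (s≤s t≤n) agree ⟩
      ∑< (suc n) g + f t        ≡⟨ cong₂ _+_ (Φ-recurrence-asc A Y n Y≡Φ t (m≤n⇒m≤1+n t≤n)) f-at-t ⟩
      Φ A t (suc n) + Φ A t n   ≡⟨ Φ-step A t n t≤n ⟨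
      Φ A (suc t) (suc n) + A n ∎)
    where
    f g : ℕ → ℕ
    f b = if t <ᵇ b then A n else Y b
    g b = if t ≤ᵇ b then A n else Y b
    agree : ∀ b → b < suc n → b ≢ t → f b ≡ g b
    agree b _ b≢t = if-cong (<ᵇ≡≤ᵇ (b≢t ∘ sym))
    f-at-t : f t ≡ Φ A t n
    f-at-t = trans (if-cong (<ᵇ-irrefl t)) (Y≡Φ t t≤n)

  Φ-recurrence-desc : ∀ A (Y : ℕ → ℕ) n → (∀ b → b ≤ n → Y b ≡ Φ A (n ∸ b) n) →
    ∀ u → u ≤ suc n → ∑< (suc n) (λ b → if b <ᵇ suc n ∸ u then A n else Y b) ≡ Φ A u (suc n)
  Φ-recurrence-desc A Y n Y≡Φ zero _ = begin
      ∑< (suc n) (λ b → if b <ᵇ suc n then A n else Y b)  ≡⟨ ∑<-cong (suc n) all-close ⟩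
      ∑< (suc n) (λ _ → A n)                             ≡⟨ ∑<-const (suc n) (A n) ⟩
      suc n * A n                                        ≡⟨ Φ-zero A n ⟨
      Φ A 0 (suc n)                                      ∎
    where
    all-close : ∀ b → b < suc n → (if b <ᵇ suc n then A n else Y b) ≡ A n
    all-close b b<n = if-cong (dec-true (b <? suc n) b<n)
  Φ-recurrence-desc A Y n Y≡Φ (suc u) (s≤s u≤n) = +-cancelʳ-≡ _ _ _ (begin
      ∑< (suc n) f + A n        ≡⟨ cong (∑< (suc n) f +_) (if-cong {x = A n} {Y t} (≤ᵇ-refl t)) ⟨
      ∑< (suc n) f + g t        ≡⟨ ∑<-exchange (suc n) t f g (s≤s (m∸n≤m n u)) agree ⟩
      ∑< (suc n) g + f t        ≡⟨ cong₂ _+_ g-sum f-at-t ⟩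
      Φ A u (suc n) + Φ A u n   ≡⟨ Φ-step A u n u≤n ⟨
      Φ A (suc u) (suc n) + A n ∎)
    where
    t = n ∸ u
    f g : ℕ → ℕ
    f b = if b <ᵇ t then A n else Y b
    g b = if b ≤ᵇ t then A n else Y b
    agree : ∀ b → b < suc n → b ≢ t → f b ≡ g b
    agree b _ b≢t = if-cong (<ᵇ≡≤ᵇ b≢t)
    f-at-t : f t ≡ Φ A u n
    f-at-t = trans (if-cong (<ᵇ-irrefl t)) (trans (Y≡Φ t (m∸n≤m n u)) (cong (λ s → Φ A s n) (m∸[m∸n]≡n u≤n)))
    g-sum : ∑< (suc n) g ≡ Φ A u (suc n)
    g-sum = trans (∑<-cong (suc n) (λ b _ → cong (λ s → if b <ᵇ s then A n else Y b) (sym (+-∸-assoc 1 u≤n))))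
                  (Φ-recurrence-desc A Y n Y≡Φ u (m≤n⇒m≤1+n u≤n))

  avoidCount : ℕ → ℕ → ℕ
  avoidCount zero    n = 0
  avoidCount (suc r) n = 1 + ∑< n (λ j → j * (n C suc j) * avoidCount r (n ∸ suc j))

  -- Whether a letter closes the first pair opened by t, given its value b after t has been removed.
  completesPair : Bool → ℕ → ℕ → Bool
  completesPair true  t b = t ≤ᵇ b
  completesPair false t b = b <ᵇ t

  -- The numbers of permutations of {0,…,n−1}, resp. of {0,…,n} beginning with t, on which the
  -- greedy scan for the pairs ordered by ori fails (see Avoiding↔Fin and AvoidingFrom↔Fin).
  nAvoiding     : ∀ {k} → (Fin k → Bool) → ℕ → ℕ
  nAvoidingFrom : ∀ {k} → (Fin (suc k) → Bool) → ℕ → ℕ → ℕ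
  nAvoiding {zero}  ori n       = 0
  nAvoiding {suc k} ori zero    = 1
  nAvoiding {suc k} ori (suc n) = ∑< (suc n) (λ a → nAvoidingFrom ori a n)
  nAvoidingFrom ori t zero    = 1
  nAvoidingFrom ori t (suc n) =
    ∑< (suc n) (λ b → if completesPair (ori zero) t b then nAvoiding (ori ∘ suc) n else nAvoidingFrom ori b n)

  module _ {k} (ori : Fin (suc k) → Bool) where

    private
      A = nAvoiding (ori ∘ suc)

    nAvoidingFrom-asc : ori zero ≡ true → ∀ n t → t ≤ n → nAvoidingFrom ori t n ≡ Φ A t n
    nAvoidingFrom-asc asc zero    .zero z≤n = refl
    nAvoidingFrom-asc asc (suc n) t     t≤n = trans
      (∑<-cong (suc n) (λ b _ → if-cong {x = A n} {nAvoidingFrom ori b n} (cong (λ o → completesPair o t b) asc)))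
      (Φ-recurrence-asc A (λ b → nAvoidingFrom ori b n) n (nAvoidingFrom-asc asc n) t t≤n)

    nAvoidingFrom-desc : ori zero ≡ false → ∀ n t → t ≤ n → nAvoidingFrom ori t n ≡ Φ A (n ∸ t) n
    nAvoidingFrom-desc desc zero    .zero z≤n = refl
    nAvoidingFrom-desc desc (suc n) t     t≤n = trans
      (∑<-cong (suc n) (λ b _ → if-cong {x = A n} {nAvoidingFrom ori b n}
                                  (cong₂ (λ o s → completesPair o s b) desc (sym (m∸[m∸n]≡n t≤n)))))
      (Φ-recurrence-desc A (λ b → nAvoidingFrom ori b n) n (nAvoidingFrom-desc desc n)
                         (suc n ∸ t) (m∸n≤m (suc n) t))

    ∑<-nAvoidingFrom : ∀ n → ∑< (suc n) (λ a → nAvoidingFrom ori a n) ≡ Φ A (suc n) (suc n)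
    ∑<-nAvoidingFrom n with ori zero in o
    ... | true  = trans
      (∑<-cong (suc n) (λ b b≤n → trans (nAvoidingFrom-asc o n b (≤-pred b≤n))
                                         (if-cong {x = A n} {Φ A b n} (sym (dec-false (suc n ≤? b) (<⇒≱ b≤n))))))
      (Φ-recurrence-asc A (λ b → Φ A b n) n (λ _ _ → refl) (suc n) ≤-refl)
    ... | false = trans
      (∑<-cong (suc n) (λ b b≤n → trans (nAvoidingFrom-desc o n b (≤-pred b≤n))
                                         (if-cong {x = A n} {Φ A (n ∸ b) n} (cong (b <ᵇ_) (sym (n∸n≡0 n))))))
      (Φ-recurrence-desc A (λ b → Φ A (n ∸ b) n) n (λ _ _ → refl) (suc n) ≤-refl)

  nAvoiding≡avoidCount : ∀ {k} (ori : Fin k → Bool) n → nAvoiding ori n ≡ avoidCount k n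
  nAvoiding≡avoidCount {zero}  ori n       = refl
  nAvoiding≡avoidCount {suc k} ori zero    = refl
  nAvoiding≡avoidCount {suc k} ori (suc n) = begin
    ∑< (suc n) (λ a → nAvoidingFrom ori a n)   ≡⟨ ∑<-nAvoidingFrom ori n ⟩
    Φ (nAvoiding (ori ∘ suc)) (suc n) (suc n)  ≡⟨ Φ-cong (nAvoiding≡avoidCount (ori ∘ suc)) (suc n) (suc n) ⟩
    Φ (avoidCount k) (suc n) (suc n)           ≡⟨ Φ-diagonal (avoidCount k) (suc n) ⟩
    avoidCount (suc k) (suc n)                 ∎

module Greedy where

  open import Data.Bool.Base using (Bool; true; false; if_then_else_)
  open import Data.Bool.Properties using (T-≡)
  open import Data.Fin.Base using (Fin; zero; suc; toℕ)
  open import Data.Fin.Properties using (toℕ<n)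
  open import Data.List.Base using (List; []; _∷_; length; drop)
  open import Data.Nat.Base
  open import Data.Nat.Properties
  open import Data.Sum.Base using (inj₁; inj₂)
  open import Function.Base using (_∘_; case_of_)
  open import Function.Bundles using (_⇔_; mk⇔; Equivalence)
  open import Relation.Binary.PropositionalEquality
  open import Relation.Nullary.Decidable using (dec-true)
  open import Relation.Nullary.Negation using (contradiction)

  open Equivalence using (to; from)

  <ᵇ≡true⇔< : ∀ {m n} → (m <ᵇ n) ≡ true ⇔ m < n
  <ᵇ≡true⇔< {m} {n} = mk⇔ (<ᵇ⇒< m n ∘ from T-≡) (dec-true (m <? n))

  <ᵇ≡false⇒≥ : ∀ {m n} → (m <ᵇ n) ≡ false → n ≤ m
  <ᵇ≡false⇒≥ {m} {n} m≮ᵇn = ≮⇒≥ (λ m<n → case trans (sym (dec-true (m <? n) m<n)) m≮ᵇn of λ ())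

  ordered : Bool → ℕ → ℕ → Bool
  ordered true  x y = x <ᵇ y
  ordered false x y = y <ᵇ x

  ordered-skip : ∀ o {x y z} → ordered o x z ≡ true → ordered o x y ≡ false → ordered o y z ≡ true
  ordered-skip true  {x} {y} {z} x<z x≮y =
    from (<ᵇ≡true⇔< {y} {z}) (≤-<-trans (<ᵇ≡false⇒≥ {x} {y} x≮y) (to (<ᵇ≡true⇔< {x} {z}) x<z))
  ordered-skip false {x} {y} {z} z<x y≮x =
    from (<ᵇ≡true⇔< {z} {y}) (<-≤-trans (to (<ᵇ≡true⇔< {z} {x}) z<x) (<ᵇ≡false⇒≥ {y} {x} y≮x))

  -- In greedyFrom ori x w, x is the candidate for the first entry of the pair ordered by ori zero.
  greedyMatch : ∀ {k} → (Fin k → Bool) → List ℕ → Bool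
  greedyFrom  : ∀ {k} → (Fin (suc k) → Bool) → ℕ → List ℕ → Bool
  greedyMatch {zero}  ori w       = true
  greedyMatch {suc k} ori []      = false
  greedyMatch {suc k} ori (x ∷ w) = greedyFrom ori x w
  greedyFrom ori x []      = false
  greedyFrom ori x (y ∷ w) = if ordered (ori zero) x y then greedyMatch (ori ∘ suc) w else greedyFrom ori y w

  double : ℕ → ℕ
  double zero    = zero
  double (suc n) = suc (suc (double n))

  double-mono : ∀ {i k} → i < k → suc (double i) < double k
  double-mono {zero}  {suc k} _         = s≤s (s≤s z≤n)
  double-mono {suc i} {suc k} (s≤s i<k) = s≤s (s≤s (double-mono i<k))

  ∸1-mono-< : ∀ {a b} → a < b → 2 ≤ b → a ∸ 1 < b ∸ 1
  ∸1-mono-< {zero}  {suc (suc _)} _         _        = s≤s z≤n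
  ∸1-mono-< {zero}  {suc zero}    _         (s≤s ())
  ∸1-mono-< {suc a} {suc b}       (s≤s a<b) _        = a<b

  -- The junk value 0 out of range is never used: occurrences only look at positions below the length.
  _‼_ : List ℕ → ℕ → ℕ
  []      ‼ _     = 0
  (x ∷ w) ‼ zero  = x
  (x ∷ w) ‼ suc p = w ‼ p

  ‼-drop : ∀ k w {p} → k ≤ p → w ‼ p ≡ drop k w ‼ (p ∸ k)
  ‼-drop zero    w       k≤p       = refl
  ‼-drop (suc k) []      k≤p       = refl
  ‼-drop (suc k) (x ∷ w) (s≤s k≤p) = ‼-drop k w k≤p

  Increasing : ℕ → (ℕ → ℕ) → Set
  Increasing K g = ∀ j → suc j < K → g j < g (suc j)

  increasing⇒≥ : ∀ {K g} → Increasing K g → ∀ j → j < K → j ≤ g j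
  increasing⇒≥ inc zero    _   = z≤n
  increasing⇒≥ inc (suc j) j<K = ≤-trans (s≤s (increasing⇒≥ inc j (<-trans (n<1+n j) j<K))) (inc j j<K)

  increasing⇒< : ∀ {K g} → Increasing K g → ∀ {j l} → j < l → l < K → g j < g l
  increasing⇒< inc {j} {suc l} (s≤s j≤l) l<K with m≤n⇒m<n∨m≡n j≤l
  ... | inj₁ j<l  = <-trans (increasing⇒< inc j<l (<-trans (n<1+n l) l<K)) (inc l l<K)
  ... | inj₂ refl = inc l l<K

  PairInOrder : ∀ {k} → (Fin k → Bool) → List ℕ → (ℕ → ℕ) → Fin k → Set
  PairInOrder ori w pos i = ordered (ori i) (w ‼ pos (double (toℕ i))) (w ‼ pos (suc (double (toℕ i)))) ≡ true

  record Occurrence {k} (ori : Fin k → Bool) (w : List ℕ) : Set where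
    constructor occurrence
    field
      pos        : ℕ → ℕ
      increasing : Increasing (double k) pos
      in-range   : ∀ j → j < double k → pos j < length w
      pairs      : ∀ i → PairInOrder ori w pos i

  occurrence-∷ : ∀ {k} {ori : Fin k → Bool} {x w} → Occurrence ori w → Occurrence ori (x ∷ w)
  occurrence-∷ (occurrence pos increasing in-range pairs) =
    occurrence (suc ∘ pos) (λ j sj<K → s≤s (increasing j sj<K)) (λ j j<K → s≤s (in-range j j<K)) pairs

  module _ {k} {ori : Fin (suc k) → Bool} {x y : ℕ} {w : List ℕ} where

    occurrence-∷-pair : ordered (ori zero) x y ≡ true → Occurrence (ori ∘ suc) w → Occurrence ori (x ∷ y ∷ w)
    occurrence-∷-pair xy (occurrence pos increasing in-range pairs) = occurrence pos′ increasing′ in-range′ pairs′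
      where
      pos′ : ℕ → ℕ
      pos′ 0             = 0
      pos′ 1             = 1
      pos′ (suc (suc j)) = suc (suc (pos j))
      increasing′ : Increasing (double (suc k)) pos′
      increasing′ 0             _               = s≤s z≤n
      increasing′ 1             _               = s≤s (s≤s z≤n)
      increasing′ (suc (suc j)) (s≤s (s≤s j<K)) = s≤s (s≤s (increasing j j<K))
      in-range′ : ∀ j → j < double (suc k) → pos′ j < length (x ∷ y ∷ w)
      in-range′ 0             _               = s≤s z≤n
      in-range′ 1             _               = s≤s (s≤s z≤n)
      in-range′ (suc (suc j)) (s≤s (s≤s j<K)) = s≤s (s≤s (in-range j j<K))
      pairs′ : ∀ i → PairInOrder ori (x ∷ y ∷ w) pos′ i
      pairs′ zero    = xy
      pairs′ (suc i) = pairs i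

    occurrence-drop-pair : Occurrence ori (x ∷ y ∷ w) → Occurrence (ori ∘ suc) w
    occurrence-drop-pair (occurrence pos increasing in-range pairs) = occurrence pos′ increasing′ in-range′ pairs′
      where
      pos′ : ℕ → ℕ
      pos′ j = pos (2 + j) ∸ 2
      beyond-first-pair : ∀ j → j < double k → 2 ≤ pos (2 + j)
      beyond-first-pair j j<K = ≤-trans (s≤s (s≤s z≤n)) (increasing⇒≥ increasing (2 + j) (s≤s (s≤s j<K)))
      increasing′ : Increasing (double k) pos′
      increasing′ j j<K =
        ∸-monoˡ-< (increasing (2 + j) (s≤s (s≤s j<K))) (beyond-first-pair j (<-trans (n<1+n j) j<K))
      in-range′ : ∀ j → j < double k → pos′ j < length w
      in-range′ j j<K = ∸-monoˡ-< (in-range (2 + j) (s≤s (s≤s j<K))) (beyond-first-pair j j<K)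
      pairs′ : ∀ i → PairInOrder (ori ∘ suc) w pos′ i
      pairs′ i = subst₂ (λ a b → ordered (ori (suc i)) a b ≡ true)
        (‼-drop 2 (x ∷ y ∷ w) (beyond-first-pair _ (<-trans (n<1+n _) (double-mono (toℕ<n i)))))
        (‼-drop 2 (x ∷ y ∷ w) (beyond-first-pair _ (double-mono (toℕ<n i))))
        (pairs (suc i))

    -- The exchange step: if x, y are not ordered like the first pair, then any letter completing
    -- a first pair started by x also completes one started by y.
    occurrence-drop-unordered : ordered (ori zero) x y ≡ false → Occurrence ori (x ∷ y ∷ w) → Occurrence ori (y ∷ w)
    occurrence-drop-unordered x≁y (occurrence pos increasing in-range pairs) = occurrence pos′ increasing′ in-range′ pairs′
      where
      K = double (suc k)
      pos′ : ℕ → ℕ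
      pos′ j = pos j ∸ 1
      ordered-at : ℕ → ℕ → Set
      ordered-at a b = ordered (ori zero) ((x ∷ y ∷ w) ‼ a) ((x ∷ y ∷ w) ‼ b) ≡ true
      x≁pos1 : pos 0 ≡ 0 → pos 1 ≢ 1
      x≁pos1 p0 p1 = case trans (sym x≁y) (subst₂ ordered-at p0 p1 (pairs zero)) of λ ()
      second≥2 : 2 ≤ pos 1
      second≥2 with pos 0 in p0 | pos 1 in p1 | increasing 0 (s≤s (s≤s z≤n))
      ... | zero  | suc zero    | _      = contradiction p1 (x≁pos1 p0)
      ... | _     | suc (suc _) | _      = s≤s (s≤s z≤n)
      ... | suc _ | suc zero    | s≤s ()
      later≥2 : ∀ j → suc j < K → 2 ≤ pos (suc j)
      later≥2 zero    _    = second≥2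
      later≥2 (suc j) sj<K = ≤-trans (s≤s (s≤s z≤n)) (increasing⇒≥ increasing (suc (suc j)) sj<K)
      increasing′ : Increasing K pos′
      increasing′ j sj<K = ∸1-mono-< (increasing j sj<K) (later≥2 j sj<K)
      in-range′ : ∀ j → j < K → pos′ j < length (y ∷ w)
      in-range′ j j<K = s≤s (∸-monoˡ-≤ 1 (≤-pred (in-range j j<K)))
      shift : ∀ j → suc j < K → (x ∷ y ∷ w) ‼ pos (suc j) ≡ (y ∷ w) ‼ pos′ (suc j)
      shift j sj<K = ‼-drop 1 (x ∷ y ∷ w) (≤-trans (s≤s z≤n) (later≥2 j sj<K))
      pairs′ : ∀ i → PairInOrder ori (y ∷ w) pos′ i
      pairs′ (suc i) = subst₂ (λ a b → ordered (ori (suc i)) a b ≡ true)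
        (shift _ (<-trans (n<1+n _) (double-mono (toℕ<n (suc i)))))
        (shift _ (double-mono (toℕ<n (suc i))))
        (pairs (suc i))
      pairs′ zero with pos 0 in p0
      ... | zero  = subst (λ b → ordered (ori zero) y b ≡ true) (shift 0 (s≤s (s≤s z≤n)))
                      (ordered-skip (ori zero) (subst (λ a → ordered-at a (pos 1)) p0 (pairs zero)) x≁y)
      ... | suc a = subst₂ (λ a b → ordered (ori zero) a b ≡ true)
                      (cong ((x ∷ y ∷ w) ‼_) p0) (shift 0 (s≤s (s≤s z≤n))) (pairs zero)

  greedyMatch-sound : ∀ {k} (ori : Fin k → Bool) w → greedyMatch ori w ≡ true → Occurrence ori w
  greedyFrom-sound  : ∀ {k} (ori : Fin (suc k) → Bool) x w → greedyFrom ori x w ≡ true → Occurrence ori (x ∷ w)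
  greedyMatch-sound {zero}  ori w       _       = occurrence (λ _ → 0) (λ _ ()) (λ _ ()) (λ ())
  greedyMatch-sound {suc k} ori (x ∷ w) matched = greedyFrom-sound ori x w matched
  greedyFrom-sound ori x (y ∷ w) matched with ordered (ori zero) x y in xy
  ... | true  = occurrence-∷-pair xy (greedyMatch-sound (ori ∘ suc) w matched)
  ... | false = occurrence-∷ (greedyFrom-sound ori y w matched)

  greedyMatch-complete : ∀ {k} (ori : Fin k → Bool) w → Occurrence ori w → greedyMatch ori w ≡ true
  greedyFrom-complete  : ∀ {k} (ori : Fin (suc k) → Bool) x w → Occurrence ori (x ∷ w) → greedyFrom ori x w ≡ true
  greedyMatch-complete {zero}  ori w       _ = refl
  greedyMatch-complete {suc k} ori []      o = contradiction (Occurrence.in-range o 0 (s≤s z≤n)) λ ()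
  greedyMatch-complete {suc k} ori (x ∷ w) o = greedyFrom-complete ori x w o
  greedyFrom-complete ori x [] (occurrence pos increasing in-range _)
    with pos 0 | pos 1 | increasing 0 (s≤s (s≤s z≤n)) | in-range 1 (s≤s (s≤s z≤n))
  ... | _ | .0 | () | s≤s z≤n
  greedyFrom-complete ori x (y ∷ w) o with ordered (ori zero) x y in xy
  ... | true  = greedyMatch-complete (ori ∘ suc) w (occurrence-drop-pair o)
  ... | false = greedyFrom-complete ori y w (occurrence-drop-unordered xy o)

module Permutations where

  open import Data.Bool.Base using (Bool; true; false; if_then_else_)
  open import Data.Bool.Properties using (if-cong; if-cong₂)
  open import Data.Fin.Base using (Fin; zero; suc; toℕ; punchIn; punchOut)
  open import Data.Fin.Properties
    using ( _≟_; suc-injective; +↔⊎; punchIn-mono-≤; punchIn-cancel-≤; punchInᵢ≢i; punchIn-injective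
          ; punchIn-punchOut; punchOut-punchIn; punchOut-cong)
  open import Data.List.Base using (List; length)
  open import Data.Nat.Base using (ℕ; zero; suc; _<_; _≤_; _<ᵇ_; s≤s; s≤s⁻¹; z≤n)
  open import Data.Nat.Properties using (_<?_; ≰⇒>; <⇒≱; +-0-commutativeMonoid)
  open import Data.Product.Base using (Σ; _×_; _,_; proj₁; proj₂)
  open import Data.Refinement using (Refinement-syntax; _,_; value-injective)
  open import Data.Irrelevant using ([_])
  open import Data.Empty.Irrelevant using (⊥-elim)
  open import Data.Sum.Base using (_⊎_; inj₁; inj₂)
  open import Data.Sum.Function.Propositional using (_⊎-↔_)
  open import Data.Vec.Base using (Vec; []; _∷_; lookup; tabulate; map; toList)
  open import Data.Vec.Properties using (lookup-map; lookup∘tabulate; tabulate∘lookup; tabulate-cong; length-toList)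
  open import Function.Base using (_∘_; case_of_)
  open import Function.Bundles using (_↔_; _⇔_; mk↔ₛ′; mk⇔; Equivalence)
  open import Function.Properties.Inverse using (↔-trans; ↔-refl)
  open import Relation.Binary.PropositionalEquality
  open import Relation.Nullary.Decidable using (yes; no; does-⇔)
  open import Defs using (IsPerm)
  open Greedy

  open FiniteSum +-0-commutativeMonoid

  vals : ∀ {n m} → Vec (Fin n) m → List ℕ
  vals v = toList (map toℕ v)

  vals-‼ : ∀ {n m} (v : Vec (Fin n) m) i → vals v ‼ toℕ i ≡ toℕ (lookup v i)
  vals-‼ (x ∷ v) zero    = refl
  vals-‼ (x ∷ v) (suc i) = vals-‼ v i

  length-vals : ∀ {n m} (v : Vec (Fin n) m) → length (vals v) ≡ m
  length-vals v = length-toList (map toℕ v)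

  punchIn-preserves-<ᵇ : ∀ {n} (a : Fin (suc n)) (x y : Fin n) →
                         (toℕ (punchIn a x) <ᵇ toℕ (punchIn a y)) ≡ (toℕ x <ᵇ toℕ y)
  punchIn-preserves-<ᵇ a x y = does-⇔ (mk⇔ reflect preserve) (_ <? _) (_ <? _)
    where
    reflect : toℕ (punchIn a x) < toℕ (punchIn a y) → toℕ x < toℕ y
    reflect ax<ay = ≰⇒> (λ y≤x → <⇒≱ ax<ay (punchIn-mono-≤ a y x y≤x))
    preserve : toℕ x < toℕ y → toℕ (punchIn a x) < toℕ (punchIn a y)
    preserve x<y = ≰⇒> (λ ay≤ax → <⇒≱ x<y (punchIn-cancel-≤ a y x ay≤ax))

  <-punchIn⇔≤ : ∀ {n} (a : Fin (suc n)) b → toℕ a < toℕ (punchIn a b) ⇔ toℕ a ≤ toℕ b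
  <-punchIn⇔≤ zero    b       = mk⇔ (λ _ → z≤n) (λ _ → s≤s z≤n)
  <-punchIn⇔≤ (suc a) zero    = mk⇔ (λ ()) (λ ())
  <-punchIn⇔≤ (suc a) (suc b) =
    mk⇔ (s≤s ∘ Equivalence.to (<-punchIn⇔≤ a b) ∘ s≤s⁻¹) (s≤s ∘ Equivalence.from (<-punchIn⇔≤ a b) ∘ s≤s⁻¹)

  punchIn-<⇔< : ∀ {n} (a : Fin (suc n)) b → toℕ (punchIn a b) < toℕ a ⇔ toℕ b < toℕ a
  punchIn-<⇔< zero    b       = mk⇔ (λ ()) (λ ())
  punchIn-<⇔< (suc a) zero    = mk⇔ (λ _ → s≤s z≤n) (λ _ → s≤s z≤n)
  punchIn-<⇔< (suc a) (suc b) =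
    mk⇔ (s≤s ∘ Equivalence.to (punchIn-<⇔< a b) ∘ s≤s⁻¹) (s≤s ∘ Equivalence.from (punchIn-<⇔< a b) ∘ s≤s⁻¹)

  module _ {n n′} (φ : Fin n → Fin n′)
           (φ-preserves-<ᵇ : ∀ x y → (toℕ (φ x) <ᵇ toℕ (φ y)) ≡ (toℕ x <ᵇ toℕ y)) where

    ordered-map : ∀ o x y → ordered o (toℕ (φ x)) (toℕ (φ y)) ≡ ordered o (toℕ x) (toℕ y)
    ordered-map true  x y = φ-preserves-<ᵇ x y
    ordered-map false x y = φ-preserves-<ᵇ y x

    greedyMatch-map : ∀ {k m} (ori : Fin k → Bool) (v : Vec (Fin n) m) →
                      greedyMatch ori (vals (map φ v)) ≡ greedyMatch ori (vals v)
    greedyFrom-map  : ∀ {k m} (ori : Fin (suc k) → Bool) x (v : Vec (Fin n) m) →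
                      greedyFrom ori (toℕ (φ x)) (vals (map φ v)) ≡ greedyFrom ori (toℕ x) (vals v)
    greedyMatch-map {zero}  ori v       = refl
    greedyMatch-map {suc k} ori []      = refl
    greedyMatch-map {suc k} ori (x ∷ v) = greedyFrom-map ori x v
    greedyFrom-map ori x []      = refl
    greedyFrom-map ori x (y ∷ v) =
      trans (if-cong (ordered-map (ori zero) x y)) (if-cong₂ _ (greedyMatch-map (ori ∘ suc) v) (greedyFrom-map ori y v))

  FailingPerms : ∀ n → (Vec (Fin n) n → Bool) → Set
  FailingPerms n test = [ π ∈ Vec (Fin n) n ∣ IsPerm π × test π ≡ false ]

  FailingPerms-cong : ∀ {n} {test test′ : Vec (Fin n) n → Bool} → (∀ π → test π ≡ test′ π) →
                      FailingPerms n test ↔ FailingPerms n test′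
  FailingPerms-cong test≗test′ = mk↔ₛ′
    (λ { (π , [ p ]) → π , [ proj₁ p , trans (sym (test≗test′ π)) (proj₂ p) ] })
    (λ { (π , [ p ]) → π , [ proj₁ p , trans (test≗test′ π) (proj₂ p) ] })
    (λ _ → value-injective refl) (λ _ → value-injective refl)

  FailingPerms-if : ∀ {n} c (test test′ : Vec (Fin n) n → Bool) →
                    FailingPerms n (λ π → if c then test π else test′ π)
                    ↔ (if c then FailingPerms n test else FailingPerms n test′)
  FailingPerms-if true  test test′ = ↔-refl
  FailingPerms-if false test test′ = ↔-refl

  FailingPerms-empty : ∀ {test} → test [] ≡ false → FailingPerms 0 test ↔ Fin 1
  FailingPerms-empty fails =
    mk↔ₛ′ (λ _ → zero) (λ _ → [] , [ (λ ()) , fails ]) (λ { zero → refl }) (λ { ([] , _) → value-injective refl })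

  punchOutOr : ∀ {n} → Fin (suc n) → Fin (suc n) → Fin n → Fin n
  punchOutOr a y d with a ≟ y
  ... | yes _  = d
  ... | no a≢y = punchOut a≢y

  punchIn-punchOutOr : ∀ {n} (a y : Fin (suc n)) d → .(a ≢ y) → punchIn a (punchOutOr a y d) ≡ y
  punchIn-punchOutOr a y d a≢y with a ≟ y
  ... | yes a≡y = ⊥-elim (a≢y a≡y)
  ... | no  a≢y = punchIn-punchOut a≢y

  punchOutOr-punchIn : ∀ {n} (a : Fin (suc n)) (j d : Fin n) → punchOutOr a (punchIn a j) d ≡ j
  punchOutOr-punchIn a j d with a ≟ punchIn a j
  ... | yes a≡aj = ⊥-elim (punchInᵢ≢i a j (sym a≡aj))
  ... | no  a≢aj = trans (punchOut-cong a refl) (punchOut-punchIn a)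

  -- The default i is only used where lookup τ i ≡ a, which cannot happen when a ∷ τ is a permutation.
  removeHead : ∀ {n} → Fin (suc n) → Vec (Fin (suc n)) n → Vec (Fin n) n
  removeHead a τ = tabulate (λ i → punchOutOr a (lookup τ i) i)

  module _ {n} (a : Fin (suc n)) where

    IsPerm-removeHead : ∀ τ → IsPerm (a ∷ τ) → IsPerm (removeHead a τ)
    IsPerm-removeHead τ perm i j eq = suc-injective (perm (suc i) (suc j) (begin
        lookup τ i                               ≡⟨ punchIn-punchOutOr a (lookup τ i) i (head-fresh i) ⟨
        punchIn a (punchOutOr a (lookup τ i) i)  ≡⟨ cong (punchIn a) (trans (sym (lookup∘tabulate _ i)) eq′) ⟩
        punchIn a (punchOutOr a (lookup τ j) j)  ≡⟨ punchIn-punchOutOr a (lookup τ j) j (head-fresh j) ⟩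
        lookup τ j                               ∎))
      where
      open ≡-Reasoning
      eq′ = trans eq (lookup∘tabulate _ j)
      head-fresh : ∀ i → a ≢ lookup τ i
      head-fresh i a≡τi with perm zero (suc i) a≡τi
      ... | ()

    IsPerm-∷-punchIn : ∀ τ′ → IsPerm τ′ → IsPerm (a ∷ map (punchIn a) τ′)
    IsPerm-∷-punchIn τ′ perm zero    zero    _  = refl
    IsPerm-∷-punchIn τ′ perm zero    (suc j) eq =
      ⊥-elim (punchInᵢ≢i a (lookup τ′ j) (trans (sym (lookup-map j (punchIn a) τ′)) (sym eq)))
    IsPerm-∷-punchIn τ′ perm (suc i) zero    eq =
      ⊥-elim (punchInᵢ≢i a (lookup τ′ i) (trans (sym (lookup-map i (punchIn a) τ′)) eq))
    IsPerm-∷-punchIn τ′ perm (suc i) (suc j) eq = cong suc (perm i j (punchIn-injective a _ _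
      (trans (sym (lookup-map i (punchIn a) τ′)) (trans eq (lookup-map j (punchIn a) τ′)))))


    removeHead-punchIn : ∀ τ′ → removeHead a (map (punchIn a) τ′) ≡ τ′
    removeHead-punchIn τ′ = trans
      (tabulate-cong (λ i → trans (cong (λ y → punchOutOr a y i) (lookup-map i (punchIn a) τ′))
                                  (punchOutOr-punchIn a (lookup τ′ i) i)))
      (tabulate∘lookup τ′)

    punchIn-removeHead : ∀ τ → .(IsPerm (a ∷ τ)) → map (punchIn a) (removeHead a τ) ≡ τ
    punchIn-removeHead τ perm = trans (sym (tabulate∘lookup _)) (trans (tabulate-cong entry) (tabulate∘lookup τ))
      where
      entry : ∀ i → lookup (map (punchIn a) (removeHead a τ)) i ≡ lookup τ i
      entry i = trans (lookup-map i (punchIn a) (removeHead a τ))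
        (trans (cong (punchIn a) (lookup∘tabulate (λ i → punchOutOr a (lookup τ i) i) i))
          (punchIn-punchOutOr a (lookup τ i) i (λ a≡τi → case perm zero (suc i) a≡τi of λ ())))

  FailingPerms-head : ∀ {n} (test : Vec (Fin (suc n)) (suc n) → Bool) →
    FailingPerms (suc n) test ↔ Σ (Fin (suc n)) (λ a → FailingPerms n (λ τ′ → test (a ∷ map (punchIn a) τ′)))
  FailingPerms-head {n} test = mk↔ₛ′ split join
    (λ { (a , _) → cong (a ,_) (value-injective (removeHead-punchIn a _)) })
    (λ { ((a ∷ τ) , [ p ]) → value-injective (cong (a ∷_) (punchIn-removeHead a τ (proj₁ p))) })
    where
    Split = Σ (Fin (suc n)) (λ a → FailingPerms n (λ τ′ → test (a ∷ map (punchIn a) τ′)))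
    split : FailingPerms (suc n) test → Split
    split ((a ∷ τ) , [ p ]) = a , (removeHead a τ , [ IsPerm-removeHead a τ (proj₁ p)
                                                    , trans (cong (test ∘ (a ∷_)) (punchIn-removeHead a τ (proj₁ p))) (proj₂ p) ])
    join : Split → FailingPerms (suc n) test
    join (a , (τ′ , [ p ])) = a ∷ map (punchIn a) τ′ , [ IsPerm-∷-punchIn a τ′ (proj₁ p) , proj₂ p ]

  Σ-Fin-suc : ∀ {k} (P : Fin (suc k) → Set) → (P zero ⊎ Σ (Fin k) (P ∘ suc)) ↔ Σ (Fin (suc k)) P
  Σ-Fin-suc P = mk↔ₛ′ to from to∘from from∘to
    where
    to : _ → Σ _ P
    to (inj₁ x)       = zero , x
    to (inj₂ (a , x)) = suc a , x
    from : Σ _ P → _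
    from (zero  , x) = inj₁ x
    from (suc a , x) = inj₂ (a , x)
    to∘from : ∀ y → to (from y) ≡ y
    to∘from (zero  , x) = refl
    to∘from (suc a , x) = refl
    from∘to : ∀ x → from (to x) ≡ x
    from∘to (inj₁ x)       = refl
    from∘to (inj₂ (a , x)) = refl

  Fin-∑< : ∀ k (h : ℕ → ℕ) → Fin (∑< k h) ↔ Σ (Fin k) (λ a → Fin (h (toℕ a)))
  Fin-∑< zero    h = mk↔ₛ′ (λ ()) (λ { (() , _) }) (λ { (() , _) }) (λ ())
  Fin-∑< (suc k) h =
    ↔-trans +↔⊎ (↔-trans (↔-refl ⊎-↔ Fin-∑< k (h ∘ suc)) (Σ-Fin-suc (λ a → Fin (h (toℕ a)))))

  if-↔ : ∀ c {X Y : Set} {x y : ℕ} → X ↔ Fin x → Y ↔ Fin y → (if c then X else Y) ↔ Fin (if c then x else y)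
  if-↔ true  X↔x Y↔y = X↔x
  if-↔ false X↔x Y↔y = Y↔y

module FirstLetter where

  open import Data.Bool.Base using (Bool; true; false; if_then_else_)
  open import Data.Bool.Properties using (if-cong; if-cong₂)
  open import Data.Fin.Base using (Fin; zero; suc; toℕ; punchIn)
  open import Data.Irrelevant using ([_])
  open import Data.Empty.Irrelevant using (⊥-elim)
  open import Data.Nat.Base using (ℕ; zero; suc)
  open import Data.Nat.Properties using (_<?_; _≤?_; +-0-commutativeMonoid)
  open import Data.Product.Base using (Σ; _,_; proj₂)
  open import Data.Product.Function.Dependent.Propositional using (congˡ)
  open import Data.Refinement using (_,_)
  open import Data.Vec.Base using (Vec; _∷_; map)
  open import Function.Base using (_∘_)
  open import Function.Bundles using (_↔_; mk↔ₛ′)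
  open import Function.Related.Propositional using (module EquationalReasoning)
  open import Relation.Binary.PropositionalEquality using (_≡_; _≢_; refl; trans)
  open import Relation.Nullary.Decidable using (does-⇔)
  open Greedy
  open Permutations
  open Counting

  open FiniteSum +-0-commutativeMonoid

  ordered-punchIn : ∀ o {n} (a : Fin (suc n)) b →
                    ordered o (toℕ a) (toℕ (punchIn a b)) ≡ completesPair o (toℕ a) (toℕ b)
  ordered-punchIn true  a b = does-⇔ (<-punchIn⇔≤ a b) (_ <? _) (_ ≤? _)
  ordered-punchIn false a b = does-⇔ (punchIn-<⇔< a b) (_ <? _) (_ <? _)

  greedyFrom-punchIn : ∀ {k n} (ori : Fin (suc k) → Bool) (a : Fin (suc (suc n))) b (ρ : Vec (Fin n) n) →
    greedyFrom ori (toℕ a) (vals (map (punchIn a) (b ∷ map (punchIn b) ρ)))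
    ≡ (if completesPair (ori zero) (toℕ a) (toℕ b)
         then greedyMatch (ori ∘ suc) (vals ρ)
         else greedyFrom ori (toℕ b) (vals (map (punchIn b) ρ)))
  greedyFrom-punchIn ori a b ρ = trans (if-cong (ordered-punchIn (ori zero) a b)) (if-cong₂ _
    (trans (greedyMatch-map (punchIn a) (punchIn-preserves-<ᵇ a) (ori ∘ suc) (map (punchIn b) ρ))
           (greedyMatch-map (punchIn b) (punchIn-preserves-<ᵇ b) (ori ∘ suc) ρ))
    (greedyFrom-map (punchIn a) (punchIn-preserves-<ᵇ a) ori b (map (punchIn b) ρ)))

  Avoiding : ∀ {k} → (Fin k → Bool) → ℕ → Set
  Avoiding ori n = FailingPerms n (greedyMatch ori ∘ vals)

  AvoidingFrom : ∀ {k} → (Fin (suc k) → Bool) → (n : ℕ) → Fin (suc n) → Set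
  AvoidingFrom ori n a = FailingPerms n (λ τ → greedyFrom ori (toℕ a) (vals (map (punchIn a) τ)))

  Avoiding↔Fin     : ∀ {k} (ori : Fin k → Bool) n → Avoiding ori n ↔ Fin (nAvoiding ori n)
  AvoidingFrom↔Fin : ∀ {k} (ori : Fin (suc k) → Bool) n a →
                     AvoidingFrom ori n a ↔ Fin (nAvoidingFrom ori (toℕ a) n)
  Avoiding↔Fin {zero} ori n = mk↔ₛ′ (λ { (_ , [ p ]) → ⊥-elim (true≢false (proj₂ p)) }) (λ ()) (λ ())
                                     (λ { (_ , [ p ]) → ⊥-elim (true≢false (proj₂ p)) })
    where
    true≢false : true ≢ false
    true≢false ()
  Avoiding↔Fin {suc k} ori zero    = FailingPerms-empty refl
  Avoiding↔Fin {suc k} ori (suc n) = begin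
      Avoiding ori (suc n)
    ↔⟨ FailingPerms-head _ ⟩
      Σ (Fin (suc n)) (AvoidingFrom ori n)
    ↔⟨ congˡ (AvoidingFrom↔Fin ori n _) ⟩
      Σ (Fin (suc n)) (λ a → Fin (nAvoidingFrom ori (toℕ a) n))
    ↔⟨ Fin-∑< (suc n) (λ a → nAvoidingFrom ori a n) ⟨
      Fin (nAvoiding ori (suc n))
    ∎
    where open EquationalReasoning
  AvoidingFrom↔Fin ori zero    a = FailingPerms-empty refl
  AvoidingFrom↔Fin ori (suc n) a = begin
      AvoidingFrom ori (suc n) a
    ↔⟨ FailingPerms-head _ ⟩
      Σ (Fin (suc n)) (λ b → FailingPerms n (continue b))
    ↔⟨ congˡ (pairs-or-restart _) ⟩
      Σ (Fin (suc n)) (λ b → Fin (next (toℕ b)))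
    ↔⟨ Fin-∑< (suc n) next ⟨
      Fin (nAvoidingFrom ori (toℕ a) (suc n))
    ∎
    where
    open EquationalReasoning
    continue : Fin (suc n) → Vec (Fin n) n → Bool
    continue b ρ = greedyFrom ori (toℕ a) (vals (map (punchIn a) (b ∷ map (punchIn b) ρ)))
    next : ℕ → ℕ
    next b = if completesPair (ori zero) (toℕ a) b then nAvoiding (ori ∘ suc) n else nAvoidingFrom ori b n
    pairs-or-restart : ∀ b → FailingPerms n (continue b) ↔ Fin (next (toℕ b))
    pairs-or-restart b = begin
        FailingPerms n (continue b)
      ↔⟨ FailingPerms-cong (greedyFrom-punchIn ori a b) ⟩
        FailingPerms n (λ ρ → if c then greedyMatch (ori ∘ suc) (vals ρ)
                                   else greedyFrom ori (toℕ b) (vals (map (punchIn b) ρ)))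
      ↔⟨ FailingPerms-if c _ _ ⟩
        (if c then Avoiding (ori ∘ suc) n else AvoidingFrom ori n b)
      ↔⟨ if-↔ c (Avoiding↔Fin (ori ∘ suc) n) (AvoidingFrom↔Fin ori n b) ⟩
        Fin (next (toℕ b))
      ∎
      where
      c = completesPair (ori zero) (toℕ a) (toℕ b)

module Chains where

  open import Data.Bool.Base using (Bool; true; false)
  open import Data.Bool.Properties using (¬-not)
  open import Data.Fin.Base using (Fin; zero; suc; toℕ; fromℕ<)
  open import Data.Fin.Properties using (toℕ<n; toℕ-fromℕ<)
  open import Data.Irrelevant using ([_])
  open import Data.List.Base using (List; []; _∷_; _++_; length)
  open import Data.Nat.Base
  open import Data.Nat.Properties
  open import Data.Product.Base using (Σ; _×_; _,_; proj₁; proj₂)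
  open import Data.Refinement using (_,_; value-injective)
  open import Data.Sum.Base using (_⊎_; inj₁; inj₂; [_,_]′)
  open import Data.Vec.Base using (Vec; lookup)
  open import Function.Base using (_∘_; const; case_of_)
  open import Function.Bundles using (_↔_; _⇔_; mk↔ₛ′; Equivalence)
  open import Relation.Binary.PropositionalEquality
  open import Relation.Nullary.Decidable using (yes; no)
  open import Relation.Nullary.Negation using (contradiction)
  open import Defs
  open Greedy
  open Permutations using (vals; vals-‼; length-vals)
  open FirstLetter using (Avoiding)

  double≡2* : ∀ n → double n ≡ 2 * n
  double≡2* zero    = refl
  double≡2* (suc n) = cong suc (trans (cong suc (double≡2* n)) (sym (+-suc n (n + 0))))

  lower upper : Bool → ℕ → ℕ
  lower true  i = double i
  lower false i = suc (double i)
  upper true  i = suc (double i)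
  upper false i = double i

  ordered⇔< : ∀ o (v : ℕ → ℕ) i →
              ordered o (v (double i)) (v (suc (double i))) ≡ true ⇔ v (lower o i) < v (upper o i)
  ordered⇔< true  v i = <ᵇ≡true⇔<
  ordered⇔< false v i = <ᵇ≡true⇔<

  lower<double : ∀ o {i k} → i < k → lower o i < double k
  lower<double true  i<k = <-trans (n<1+n _) (double-mono i<k)
  lower<double false i<k = double-mono i<k

  upper<double : ∀ o {i k} → i < k → upper o i < double k
  upper<double true  i<k = double-mono i<k
  upper<double false i<k = <-trans (n<1+n _) (double-mono i<k)

  two-element : ∀ {a b p q : ℕ} xs ys zs → xs ++ (b ∷ ys ++ (a ∷ zs)) ≡ p ∷ q ∷ [] → b ≡ p × a ≡ q
  two-element []              []          zs refl = refl , refl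
  two-element []              (_ ∷ [])    zs ()
  two-element []              (_ ∷ _ ∷ _) zs ()
  two-element (_ ∷ [])        []          zs ()
  two-element (_ ∷ [])        (_ ∷ _)     zs ()
  two-element (_ ∷ _ ∷ [])    _           zs ()
  two-element (_ ∷ _ ∷ _ ∷ _) _           zs ()

  isAscending : ∀ {A B : Set} → A ⊎ B → Bool
  isAscending = [ const false , const true ]′

  module _ {m} (chains : Vec (List ℕ) m)
    (shape : ∀ (i : Fin m) →
      (lookup chains i ≡ suc (2 * toℕ i) ∷ (2 + 2 * toℕ i) ∷ [])
      ⊎ (lookup chains i ≡ (2 + 2 * toℕ i) ∷ suc (2 * toℕ i) ∷ [])) where

    -- orientation i is true iff σᵢ = (2i+2, 2i+1), i.e. iff the entries of an occurrence at
    -- positions 2i and 2i+1 must increase.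
    orientation : Fin m → Bool
    orientation i = isAscending (shape i)

    private
      Less = PopLess chains {2 * m}
      lo up : Fin m → ℕ
      lo i = lower (orientation i) (toℕ i)
      up i = upper (orientation i) (toℕ i)

    chain-shape : ∀ i → lookup chains i ≡ suc (up i) ∷ suc (lo i) ∷ []
    chain-shape i = by-shape (shape i)
      where
      d≡ = double≡2* (toℕ i)
      by-shape : ∀ s → lookup chains i ≡ suc (upper (isAscending s) (toℕ i)) ∷ suc (lower (isAscending s) (toℕ i)) ∷ []
      by-shape (inj₁ desc) = trans desc (sym (cong₂ (λ a b → suc a ∷ suc (suc b) ∷ []) d≡ d≡))
      by-shape (inj₂ asc)  = trans asc  (sym (cong₂ (λ a b → suc (suc a) ∷ suc b ∷ []) d≡ d≡))

    Less⇒pair : ∀ {j l} → Less j l → Σ (Fin m) λ i → toℕ j ≡ lo i × toℕ l ≡ up i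
    Less⇒pair (i , xs , ys , zs , chain≡) with two-element xs ys zs (trans (sym chain≡) (chain-shape i))
    ... | l≡ , j≡ = i , suc-injective j≡ , suc-injective l≡

    pair⇒Less : ∀ i {j l} → toℕ j ≡ lo i → toℕ l ≡ up i → Less j l
    pair⇒Less i j≡ l≡ = i , [] , [] , [] , trans (chain-shape i) (sym (cong₂ (λ a b → suc a ∷ suc b ∷ []) l≡ j≡))

    module _ {n} (π : Vec (Fin n) n) where

      private
        at : (ℕ → ℕ) → ℕ → ℕ
        at pos p = vals π ‼ pos p

      occurs⇒occurrence : Occurs Less π → Occurrence orientation (vals π)
      occurs⇒occurrence (f , mono , rel) = occurrence pos increasing in-range pairs
        where
        pos : ℕ → ℕ
        pos j with j <? 2 * m
        ... | yes j<2m = toℕ (f (fromℕ< j<2m))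
        ... | no  _    = 0
        pos≡ : ∀ {j} (j<2m : j < 2 * m) → pos j ≡ toℕ (f (fromℕ< j<2m))
        pos≡ {j} j<2m with j <? 2 * m
        ... | yes _    = refl
        ... | no  j≮2m = contradiction j<2m j≮2m
        below : ∀ {j} → j < double m → j < 2 * m
        below {j} = subst (j <_) (double≡2* m)
        increasing : Increasing (double m) pos
        increasing j sj<K = subst₂ _<_ (sym (pos≡ j<2m)) (sym (pos≡ sj<2m))
          (mono _ _ (subst₂ _<_ (sym (toℕ-fromℕ< j<2m)) (sym (toℕ-fromℕ< sj<2m)) (n<1+n j)))
          where
          sj<2m = below sj<K
          j<2m  = <-trans (n<1+n j) sj<2m
        in-range : ∀ j → j < double m → pos j < length (vals π)
        in-range j j<K = subst₂ _<_ (sym (pos≡ (below j<K))) (sym (length-vals π)) (toℕ<n _)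
        value : ∀ {j} (j<2m : j < 2 * m) → at pos j ≡ toℕ (lookup π (f (fromℕ< j<2m)))
        value j<2m = trans (cong (vals π ‼_) (pos≡ j<2m)) (vals-‼ π _)
        pairs : ∀ i → PairInOrder orientation (vals π) pos i
        pairs i = Equivalence.from (ordered⇔< (orientation i) (at pos) (toℕ i))
          (subst₂ _<_ (sym (value lo<2m)) (sym (value up<2m))
                  (rel _ _ (pair⇒Less i (toℕ-fromℕ< lo<2m) (toℕ-fromℕ< up<2m))))
          where
          lo<2m = below (lower<double (orientation i) (toℕ<n i))
          up<2m = below (upper<double (orientation i) (toℕ<n i))

      occurrence⇒occurs : Occurrence orientation (vals π) → Occurs Less π
      occurrence⇒occurs (occurrence pos increasing in-range pairs) = f , mono , rel
        where
        within : ∀ (j : Fin (2 * m)) → toℕ j < double m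
        within j = subst (toℕ j <_) (sym (double≡2* m)) (toℕ<n j)
        f : Fin (2 * m) → Fin n
        f j = fromℕ< (subst (pos (toℕ j) <_) (length-vals π) (in-range (toℕ j) (within j)))
        mono : ∀ j l → toℕ j < toℕ l → toℕ (f j) < toℕ (f l)
        mono j l j<l = subst₂ _<_ (sym (toℕ-fromℕ< _)) (sym (toℕ-fromℕ< _)) (increasing⇒< increasing j<l (within l))
        value : ∀ j → toℕ (lookup π (f j)) ≡ at pos (toℕ j)
        value j = trans (sym (vals-‼ π (f j))) (cong (vals π ‼_) (toℕ-fromℕ< _))
        rel : ∀ j l → Less j l → toℕ (lookup π (f j)) < toℕ (lookup π (f l))
        rel j l j<l with Less⇒pair j<l
        ... | i , j≡ , l≡ = subst₂ _<_ (sym (trans (value j) (cong (at pos) j≡))) (sym (trans (value l) (cong (at pos) l≡)))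
          (Equivalence.to (ordered⇔< (orientation i) (at pos) (toℕ i)) (pairs i))

    Avoiders↔Avoiding : ∀ n → Avoiders Less n ↔ Avoiding orientation n
    Avoiders↔Avoiding n = mk↔ₛ′ to from (λ _ → value-injective refl) (λ _ → value-injective refl)
      where
      to : Avoiders Less n → Avoiding orientation n
      to (π , [ p ]) = π , [ proj₁ p , ¬-not (proj₂ p ∘ occurrence⇒occurs π ∘ greedyMatch-sound orientation (vals π)) ]
      from : Avoiding orientation n → Avoiders Less n
      from (π , [ p ]) = π , [ proj₁ p , (λ occ → case trans (sym (found occ)) (proj₂ p) of λ ()) ]
        where
        found : Occurs Less π → greedyMatch orientation (vals π) ≡ true
        found = greedyMatch-complete orientation (vals π) ∘ occurs⇒occurrence π

module PowerSeries where

  import Data.Integer.Base as ℤ using (+_; _+_)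
  import Data.Integer.Properties as ℤ
  open import Data.List.Base using (map; applyUpTo)
  open import Data.Nat.Base as ℕ using (ℕ; zero; suc; _∸_; _!; _≤_; _<_; NonZero)
  import Data.Nat.Properties as ℕ
  open import Data.Nat.Combinatorics using (_C_)
  open import Data.Nat.Combinatorics.Specification using (nCk≡n!/k![n-k]!)
  open import Data.Nat.Combinatorics using (k![n∸k]!∣n!)
  open import Data.Nat.DivMod using (m/n*n≡m)
  open import Data.Nat.Tactic.RingSolver using (solve-∀)
  open import Data.Rational.Base using (ℚ; 0ℚ; 1ℚ; _/_; _+_; _*_; _-_)
  open import Data.Rational.Properties
    using (toℚᵘ-injective; toℚᵘ-fromℚᵘ; toℚᵘ-homo-*; toℚᵘ-homo-+; fromℚᵘ-cong; /-cong)
  import Data.Rational.Properties as ℚ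
  open import Data.Rational.Solver using (module +-*-Solver)
  import Data.Rational.Unnormalised.Base as ℚᵘ
  import Data.Rational.Unnormalised.Properties as ℚᵘ
  open import Function.Base using (_∘_; id)
  open import Relation.Binary.PropositionalEquality
  open import Defs
  open Counting using (avoidCount)

  open ≡-Reasoning

  frac : ℕ → (d : ℕ) → .{{NonZero d}} → ℚ
  frac a d = ℤ.+ a / d

  frac-≡ : ∀ a b c d .{{_ : NonZero b}} .{{_ : NonZero d}} → a ℕ.* d ≡ c ℕ.* b → frac a b ≡ frac c d
  frac-≡ a (suc b) c (suc d) ad≡cb = fromℚᵘ-cong {ℚᵘ.mkℚᵘ (ℤ.+ a) b} {ℚᵘ.mkℚᵘ (ℤ.+ c) d}
    (ℚᵘ.*≡* (trans (sym (ℤ.pos-* a (suc d))) (trans (cong ℤ.+_ ad≡cb) (ℤ.pos-* c (suc b)))))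

  frac-* : ∀ a b c d .{{_ : NonZero b}} .{{_ : NonZero d}} →
           frac a b * frac c d ≡ frac (a ℕ.* c) (b ℕ.* d) {{ℕ.m*n≢0 b d}}
  frac-* a (suc b) c (suc d) = trans
    (toℚᵘ-injective (ℚᵘ.≃-trans (toℚᵘ-homo-* (frac a (suc b)) (frac c (suc d)))
      (ℚᵘ.≃-trans (ℚᵘ.*-cong (toℚᵘ-fromℚᵘ p) (toℚᵘ-fromℚᵘ q))
                  (ℚᵘ.≃-sym (toℚᵘ-fromℚᵘ (p ℚᵘ.* q))))))
    (/-cong (sym (ℤ.pos-* a c)) refl)
    where
    p = ℚᵘ.mkℚᵘ (ℤ.+ a) b
    q = ℚᵘ.mkℚᵘ (ℤ.+ c) d

  frac-+ : ∀ a b c d .{{_ : NonZero b}} .{{_ : NonZero d}} →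
           frac a b + frac c d ≡ frac (a ℕ.* d ℕ.+ c ℕ.* b) (b ℕ.* d) {{ℕ.m*n≢0 b d}}
  frac-+ a (suc b) c (suc d) = trans
    (toℚᵘ-injective (ℚᵘ.≃-trans (toℚᵘ-homo-+ (frac a (suc b)) (frac c (suc d)))
      (ℚᵘ.≃-trans (ℚᵘ.+-cong (toℚᵘ-fromℚᵘ p) (toℚᵘ-fromℚᵘ q))
                  (ℚᵘ.≃-sym (toℚᵘ-fromℚᵘ (p ℚᵘ.+ q))))))
    (/-cong (trans (cong₂ ℤ._+_ (sym (ℤ.pos-* a (suc d))) (sym (ℤ.pos-* c (suc b))))
                   (sym (ℤ.pos-+ (a ℕ.* suc d) (c ℕ.* suc b))))
            refl)
    where
    p = ℚᵘ.mkℚᵘ (ℤ.+ a) b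
    q = ℚᵘ.mkℚᵘ (ℤ.+ c) d

  fromℕ : ℕ → ℚ
  fromℕ k = frac k 1

  invFact : ℕ → ℚ
  invFact n = frac 1 (n !) {{n ℕ.!≢0}}

  fromℕ-+ : ∀ a b → fromℕ (a ℕ.+ b) ≡ fromℕ a + fromℕ b
  fromℕ-+ a b = sym (trans (frac-+ a 1 b 1) (frac-≡ (a ℕ.* 1 ℕ.+ b ℕ.* 1) 1 (a ℕ.+ b) 1 (rearrange a b)))
    where
    rearrange : ∀ a b → (a ℕ.* 1 ℕ.+ b ℕ.* 1) ℕ.* 1 ≡ (a ℕ.+ b) ℕ.* (1 ℕ.* 1)
    rearrange = solve-∀

  frac-*≡ : ∀ a b c d e f .{{_ : NonZero b}} .{{_ : NonZero d}} .{{_ : NonZero f}} →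
            a ℕ.* c ℕ.* f ≡ e ℕ.* (b ℕ.* d) → frac a b * frac c d ≡ frac e f
  frac-*≡ a b c d e f eq = trans (frac-* a b c d) (frac-≡ (a ℕ.* c) (b ℕ.* d) e f {{ℕ.m*n≢0 b d}} eq)

  fromℕ-* : ∀ a b → fromℕ (a ℕ.* b) ≡ fromℕ a * fromℕ b
  fromℕ-* a b = sym (frac-*≡ a 1 b 1 (a ℕ.* b) 1 (rearrange a b))
    where
    rearrange : ∀ a b → a ℕ.* b ℕ.* 1 ≡ a ℕ.* b ℕ.* (1 ℕ.* 1)
    rearrange = solve-∀

  frac-! : ∀ a n → frac a (n !) {{n ℕ.!≢0}} ≡ fromℕ a * invFact n
  frac-! a n = sym (frac-*≡ a 1 1 (n !) a (n !) {{_}} {{n ℕ.!≢0}} {{n ℕ.!≢0}} (rearrange a (n !)))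
    where
    rearrange : ∀ a f → a ℕ.* 1 ℕ.* f ≡ a ℕ.* (1 ℕ.* f)
    rearrange = solve-∀

  invFact-suc : ∀ n → invFact n ≡ (1ℚ + fromℕ n) * invFact (suc n)
  invFact-suc n = begin
    invFact n
      ≡⟨ frac-*≡ (suc n) 1 1 (suc n !) 1 (n !) {{_}} {{suc n ℕ.!≢0}} {{n ℕ.!≢0}} (rearrange n (n !)) ⟨
    fromℕ (1 ℕ.+ n) * invFact (suc n)
      ≡⟨ cong (_* invFact (suc n)) (fromℕ-+ 1 n) ⟩
    (1ℚ + fromℕ n) * invFact (suc n)
      ∎
    where
    rearrange : ∀ n f → suc n ℕ.* 1 ℕ.* f ≡ 1 ℕ.* (1 ℕ.* (f ℕ.+ n ℕ.* f))
    rearrange = solve-∀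

  binomial-factorials : ∀ {n k} → k ≤ n → (n C k) ℕ.* (k ! ℕ.* (n ∸ k) !) ≡ n !
  binomial-factorials {n} {k} k≤n =
    trans (cong (ℕ._* (k ! ℕ.* (n ∸ k) !)) (nCk≡n!/k![n-k]! k≤n))
          (m/n*n≡m {{k ℕ.!* (n ∸ k) !≢0}} (k![n∸k]!∣n! k≤n))

  C-invFact : ∀ {n k} → k ≤ n → fromℕ (n C k) * invFact n ≡ invFact k * invFact (n ∸ k)
  C-invFact {n} {k} k≤n = trans
    (frac-*≡ (n C k) 1 1 (n !) 1 (k ! ℕ.* (n ∸ k) !) {{_}} {{n ℕ.!≢0}} {{k ℕ.!* (n ∸ k) !≢0}} cross)
    (sym (frac-* 1 (k !) 1 ((n ∸ k) !) {{k ℕ.!≢0}} {{(n ∸ k) ℕ.!≢0}}))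
    where
    cross : (n C k) ℕ.* 1 ℕ.* (k ! ℕ.* (n ∸ k) !) ≡ 1 ℕ.* (1 ℕ.* n !)
    cross = trans (cong (ℕ._* (k ! ℕ.* (n ∸ k) !)) (ℕ.*-identityʳ (n C k)))
                  (trans (binomial-factorials k≤n) (sym (trans (ℕ.*-identityˡ _) (ℕ.*-identityˡ _))))

  module ℕ∑ = FiniteSum ℕ.+-0-commutativeMonoid
  open FiniteSum ℚ.+-0-commutativeMonoid
  open +-*-Solver

  ∑<-sub : ∀ k (f g : ℕ → ℚ) → ∑< k (λ i → f i - g i) ≡ ∑< k f - ∑< k g
  ∑<-sub zero    f g = refl
  ∑<-sub (suc k) f g = trans (cong ((f 0 - g 0) +_) (∑<-sub k (f ∘ suc) (g ∘ suc)))
    (solve 4 (λ a b c d → (a :- b) :+ (c :- d) := (a :+ c) :- (b :+ d)) refl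
             (f 0) (g 0) (∑< k (f ∘ suc)) (∑< k (g ∘ suc)))

  *-distribˡ-∑< : ∀ c k (f : ℕ → ℚ) → c * ∑< k f ≡ ∑< k (λ i → c * f i)
  *-distribˡ-∑< c = ∑<-homo {M = ℚ.+-0-commutativeMonoid} {N = ℚ.+-0-commutativeMonoid}
                            (c *_) (ℚ.*-zeroʳ c) (ℚ.*-distribˡ-+ c)

  fromℕ-∑< : ∀ k (f : ℕ → ℕ) → fromℕ (ℕ∑.∑< k f) ≡ ∑< k (fromℕ ∘ f)
  fromℕ-∑< = ∑<-homo {M = ℕ.+-0-commutativeMonoid} {N = ℚ.+-0-commutativeMonoid} fromℕ refl fromℕ-+

  ⊛-∑< : ∀ F G n → (F ⊛ G) n ≡ ∑< (suc n) (λ i → F i * G (n ∸ i))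
  ⊛-∑< F G n = sum-applyUpTo id (suc n)
    where
    sum-applyUpTo : ∀ (g : ℕ → ℕ) k →
                    sumℚ (map (λ i → F i * G (n ∸ i)) (applyUpTo g k)) ≡ ∑< k (λ i → F (g i) * G (n ∸ g i))
    sum-applyUpTo g zero    = refl
    sum-applyUpTo g (suc k) = cong (F (g 0) * G (n ∸ g 0) +_) (sum-applyUpTo (g ∘ suc) k)

  ⊛-congˡ : ∀ {F F′} G → (∀ i → F i ≡ F′ i) → ∀ n → (F ⊛ G) n ≡ (F′ ⊛ G) n
  ⊛-congˡ {F} {F′} G F≗F′ n = begin
    (F ⊛ G) n                             ≡⟨ ⊛-∑< F G n ⟩
    ∑< (suc n) (λ i → F i * G (n ∸ i))    ≡⟨ ∑<-cong (suc n) (λ i _ → cong (_* G (n ∸ i)) (F≗F′ i)) ⟩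
    ∑< (suc n) (λ i → F′ i * G (n ∸ i))   ≡⟨ ⊛-∑< F′ G n ⟨
    (F′ ⊛ G) n                            ∎

  ⊛-congʳ : ∀ F {G G′} → (∀ i → G i ≡ G′ i) → ∀ n → (F ⊛ G) n ≡ (F ⊛ G′) n
  ⊛-congʳ F {G} {G′} G≗G′ n = begin
    (F ⊛ G) n                             ≡⟨ ⊛-∑< F G n ⟩
    ∑< (suc n) (λ i → F i * G (n ∸ i))    ≡⟨ ∑<-cong (suc n) (λ i _ → cong (F i *_) (G≗G′ (n ∸ i))) ⟩
    ∑< (suc n) (λ i → F i * G′ (n ∸ i))   ≡⟨ ⊛-∑< F G′ n ⟨
    (F ⊛ G′) n                            ∎

  ⊛-oneS : ∀ F n → (F ⊛ oneS) n ≡ F n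
  ⊛-oneS F n = begin
    (F ⊛ oneS) n        ≡⟨ trans (⊛-∑< F oneS n) (∑<-last n term) ⟩
    ∑< n term + term n  ≡⟨ cong₂ _+_ (∑<-zero n vanish) (cong (λ e → F n * oneS e) (ℕ.n∸n≡0 n)) ⟩
    0ℚ + F n * 1ℚ       ≡⟨ solve 1 (λ a → con 0ℚ :+ a :* con 1ℚ := a) refl (F n) ⟩
    F n                 ∎
    where
    term : ℕ → ℚ
    term i = F i * oneS (n ∸ i)
    vanish : ∀ i → i < n → term i ≡ 0ℚ
    vanish i i<n = trans (cong (λ e → F i * oneS e) (ℕ.+-∸-assoc 1 i<n)) (ℚ.*-zeroʳ (F i))

  ⊛-⊖ : ∀ F G H n → (F ⊛ (G ⊖ H)) n ≡ (F ⊛ G) n - (F ⊛ H) n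
  ⊛-⊖ F G H n = begin
      (F ⊛ (G ⊖ H)) n
    ≡⟨ ⊛-∑< F (G ⊖ H) n ⟩
      ∑< (suc n) (λ i → F i * (G (n ∸ i) - H (n ∸ i)))
    ≡⟨ ∑<-cong (suc n) (λ i _ → distrib (F i) (G (n ∸ i)) (H (n ∸ i))) ⟩
      ∑< (suc n) (λ i → FG i - FH i)
    ≡⟨ ∑<-sub (suc n) FG FH ⟩
      ∑< (suc n) FG - ∑< (suc n) FH
    ≡⟨ cong₂ _-_ (⊛-∑< F G n) (⊛-∑< F H n) ⟨
      (F ⊛ G) n - (F ⊛ H) n
    ∎
    where
    FG FH : ℕ → ℚ
    FG i = F i * G (n ∸ i)
    FH i = F i * H (n ∸ i)
    distrib : ∀ f x y → f * (x - y) ≡ f * x - f * y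
    distrib = solve 3 (λ f x y → f :* (x :- y) := f :* x :- f :* y) refl

  Δ : Series → Series
  Δ F zero    = F 0
  Δ F (suc n) = F (suc n) - F n

  Δ-cong : ∀ {F F′} → (∀ i → F i ≡ F′ i) → ∀ n → Δ F n ≡ Δ F′ n
  Δ-cong F≗F′ zero    = F≗F′ 0
  Δ-cong F≗F′ (suc n) = cong₂ _-_ (F≗F′ (suc n)) (F≗F′ n)

  Δ-⊕ : ∀ F G n → Δ (F ⊕ G) n ≡ Δ F n + Δ G n
  Δ-⊕ F G zero    = refl
  Δ-⊕ F G (suc n) =
    solve 4 (λ a b c d → (a :+ b) :- (c :+ d) := (a :- c) :+ (b :- d)) refl (F (suc n)) (G (suc n)) (F n) (G n)

  ⊛-[1-x] : ∀ F n → (F ⊛ (oneS ⊖ xS)) n ≡ Δ F n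
  ⊛-[1-x] F zero    =
    trans (⊛-∑< F (oneS ⊖ xS) 0) (solve 1 (λ a → a :* (con 1ℚ :- con 0ℚ) :+ con 0ℚ := a) refl (F 0))
  ⊛-[1-x] F (suc k) = begin
      (F ⊛ (oneS ⊖ xS)) (suc k)
    ≡⟨ trans (⊛-∑< F (oneS ⊖ xS) (suc k)) (∑<-last (suc k) term) ⟩
      ∑< (suc k) term + term (suc k)
    ≡⟨ cong (_+ term (suc k)) (∑<-last k term) ⟩
      (∑< k term + term k) + term (suc k)
    ≡⟨ cong₂ (λ a e → (a + term k) + F (suc k) * (oneS ⊖ xS) e) (∑<-zero k vanish) (ℕ.n∸n≡0 k) ⟩
      (0ℚ + term k) + F (suc k) * (1ℚ - 0ℚ)
    ≡⟨ cong (λ e → (0ℚ + F k * (oneS ⊖ xS) e) + F (suc k) * (1ℚ - 0ℚ)) (ℕ.m+n∸n≡m 1 k) ⟩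
      (0ℚ + F k * (0ℚ - 1ℚ)) + F (suc k) * (1ℚ - 0ℚ)
    ≡⟨ solve 2 (λ a b → (con 0ℚ :+ a :* (con 0ℚ :- con 1ℚ)) :+ b :* (con 1ℚ :- con 0ℚ) := b :- a) refl
               (F k) (F (suc k)) ⟩
      F (suc k) - F k
    ∎
    where
    term : ℕ → ℚ
    term i = F i * (oneS ⊖ xS) (suc k ∸ i)
    vanish : ∀ i → i < k → term i ≡ 0ℚ
    vanish i i<k = trans
      (cong (λ e → F i * (oneS ⊖ xS) e) (trans (ℕ.+-∸-assoc 1 (ℕ.<⇒≤ i<k)) (cong suc (ℕ.+-∸-assoc 1 i<k))))
      (ℚ.*-zeroʳ (F i))

  Δ-⊛ : ∀ F H n → Δ (F ⊛ H) n ≡ (F ⊛ Δ H) n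
  Δ-⊛ F H zero    = trans (⊛-∑< F H 0) (sym (⊛-∑< F (Δ H) 0))
  Δ-⊛ F H (suc k) = begin
      (F ⊛ H) (suc k) - (F ⊛ H) k
    ≡⟨ cong₂ _-_ (trans (⊛-∑< F H (suc k)) (∑<-last (suc k) now)) (⊛-∑< F H k) ⟩
      (∑< (suc k) now + now (suc k)) - ∑< (suc k) before
    ≡⟨ solve 3 (λ x y z → (x :+ y) :- z := (x :- z) :+ y) refl (∑< (suc k) now) (now (suc k)) (∑< (suc k) before) ⟩
      (∑< (suc k) now - ∑< (suc k) before) + now (suc k)
    ≡⟨ cong₂ _+_ (sym (trans (∑<-cong (suc k) differences) (∑<-sub (suc k) now before))) last-term ⟩
      ∑< (suc k) diff + diff (suc k)
    ≡⟨ trans (⊛-∑< F (Δ H) (suc k)) (∑<-last (suc k) diff) ⟨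
      (F ⊛ Δ H) (suc k)
    ∎
    where
    now before diff : ℕ → ℚ
    now    i = F i * H (suc k ∸ i)
    before i = F i * H (k ∸ i)
    diff   i = F i * Δ H (suc k ∸ i)
    differences : ∀ i → i < suc k → diff i ≡ now i - before i
    differences i i<sk = begin
      F i * Δ H (suc k ∸ i)                  ≡⟨ cong (λ e → F i * Δ H e) (ℕ.+-∸-assoc 1 (ℕ.≤-pred i<sk)) ⟩
      F i * (H (suc (k ∸ i)) - H (k ∸ i))    ≡⟨ solve 3 (λ f x y → f :* (x :- y) := f :* x :- f :* y) refl (F i) _ _ ⟩
      F i * H (suc (k ∸ i)) - before i       ≡⟨ cong (λ e → F i * H e - before i) (ℕ.+-∸-assoc 1 (ℕ.≤-pred i<sk)) ⟨
      now i - before i                       ∎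
    last-term : now (suc k) ≡ diff (suc k)
    last-term = trans (cong (λ e → F (suc k) * H e) (ℕ.n∸n≡0 k)) (cong (λ e → F (suc k) * Δ H e) (sym (ℕ.n∸n≡0 k)))

  B : Series
  B = oneS ⊕ (xS ⊖ oneS) ⊛ expS

  b : Series
  b zero    = 0ℚ
  b (suc j) = fromℕ j * invFact (suc j)

  B≗b : ∀ n → B n ≡ b n
  B≗b zero    = trans (cong (1ℚ +_) (⊛-∑< (xS ⊖ oneS) expS 0))
                      (solve 0 (con 1ℚ :+ ((con 0ℚ :- con 1ℚ) :* con 1ℚ :+ con 0ℚ) := con 0ℚ) refl)
  B≗b (suc j) = begin
      0ℚ + ((xS ⊖ oneS) ⊛ expS) (suc j)
    ≡⟨ cong (0ℚ +_) (⊛-∑< (xS ⊖ oneS) expS (suc j)) ⟩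
      0ℚ + ((0ℚ - 1ℚ) * invFact (suc j) + ((1ℚ - 0ℚ) * invFact j + ∑< j term))
    ≡⟨ cong₂ (λ u s → 0ℚ + ((0ℚ - 1ℚ) * invFact (suc j) + ((1ℚ - 0ℚ) * u + s)))
             (invFact-suc j) (∑<-zero j (λ i _ → ℚ.*-zeroˡ (expS (j ∸ suc i)))) ⟩
      0ℚ + ((0ℚ - 1ℚ) * invFact (suc j) + ((1ℚ - 0ℚ) * ((1ℚ + fromℕ j) * invFact (suc j)) + 0ℚ))
    ≡⟨ solve 2 (λ U J → con 0ℚ :+ ((con 0ℚ :- con 1ℚ) :* U
                                    :+ ((con 1ℚ :- con 0ℚ) :* ((con 1ℚ :+ J) :* U) :+ con 0ℚ))
                        := J :* U)
               refl (invFact (suc j)) (fromℕ j) ⟩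
      fromℕ j * invFact (suc j)
    ∎
    where
    term : ℕ → ℚ
    term i = (xS (suc (suc i)) - oneS (suc (suc i))) * expS (suc j ∸ suc (suc i))

  Δexp+b≡1 : ∀ n → Δ expS n + b n ≡ oneS n
  Δexp+b≡1 zero    = refl
  Δexp+b≡1 (suc j) = trans (cong (λ u → (invFact (suc j) - u) + fromℕ j * invFact (suc j)) (invFact-suc j))
    (solve 2 (λ U J → (U :- (con 1ℚ :+ J) :* U) :+ J :* U := con 0ℚ) refl (invFact (suc j)) (fromℕ j))

  EGF-avoidCount-suc : ∀ r n → EGF (avoidCount (suc r)) n ≡ expS n + (b ⊛ EGF (avoidCount r)) n
  EGF-avoidCount-suc r n = trans from-count (sym from-product)
    where
    T = avoidCount r
    count : ℕ → ℕ
    count j = j ℕ.* (n C suc j) ℕ.* T (n ∸ suc j)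
    term : ℕ → ℚ
    term j = fromℕ j * (invFact (suc j) * invFact (n ∸ suc j)) * fromℕ (T (n ∸ suc j))
    count-term : ∀ j → j < n → invFact n * fromℕ (count j) ≡ term j
    count-term j j<n = begin
        invFact n * fromℕ (count j)
      ≡⟨ cong (invFact n *_) (trans (fromℕ-* (j ℕ.* (n C suc j)) (T (n ∸ suc j)))
                                    (cong (_* fromℕ (T (n ∸ suc j))) (fromℕ-* j (n C suc j)))) ⟩
        invFact n * ((fromℕ j * fromℕ (n C suc j)) * fromℕ (T (n ∸ suc j)))
      ≡⟨ solve 4 (λ U J C X → U :* ((J :* C) :* X) := J :* (C :* U) :* X) refl
                 (invFact n) (fromℕ j) (fromℕ (n C suc j)) (fromℕ (T (n ∸ suc j))) ⟩
        fromℕ j * (fromℕ (n C suc j) * invFact n) * fromℕ (T (n ∸ suc j))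
      ≡⟨ cong (λ e → fromℕ j * e * fromℕ (T (n ∸ suc j))) (C-invFact j<n) ⟩
        term j
      ∎
    from-count : EGF (avoidCount (suc r)) n ≡ invFact n + ∑< n term
    from-count = begin
        EGF (avoidCount (suc r)) n
      ≡⟨ frac-! (avoidCount (suc r) n) n ⟩
        fromℕ (1 ℕ.+ ℕ∑.∑< n count) * invFact n
      ≡⟨ cong (_* invFact n) (trans (fromℕ-+ 1 (ℕ∑.∑< n count)) (cong (1ℚ +_) (fromℕ-∑< n count))) ⟩
        (1ℚ + ∑< n (fromℕ ∘ count)) * invFact n
      ≡⟨ solve 2 (λ a U → (con 1ℚ :+ a) :* U := U :+ U :* a) refl (∑< n (fromℕ ∘ count)) (invFact n) ⟩
        invFact n + invFact n * ∑< n (fromℕ ∘ count)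
      ≡⟨ cong (invFact n +_) (trans (*-distribˡ-∑< (invFact n) n (fromℕ ∘ count)) (∑<-cong n count-term)) ⟩
        invFact n + ∑< n term
      ∎
    product-term : ∀ j → j < n → b (suc j) * EGF T (n ∸ suc j) ≡ term j
    product-term j _ = trans (cong (b (suc j) *_) (frac-! (T (n ∸ suc j)) (n ∸ suc j)))
      (solve 4 (λ J U V X → (J :* U) :* (X :* V) := J :* (U :* V) :* X) refl
               (fromℕ j) (invFact (suc j)) (invFact (n ∸ suc j)) (fromℕ (T (n ∸ suc j))))
    from-product : expS n + (b ⊛ EGF T) n ≡ invFact n + ∑< n term
    from-product = cong (invFact n +_) (begin
        (b ⊛ EGF T) n
      ≡⟨ ⊛-∑< b (EGF T) n ⟩
        0ℚ * EGF T n + ∑< n (λ j → b (suc j) * EGF T (n ∸ suc j))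
      ≡⟨ cong (0ℚ * EGF T n +_) (∑<-cong n product-term) ⟩
        0ℚ * EGF T n + ∑< n term
      ≡⟨ solve 2 (λ a s → con 0ℚ :* a :+ s := s) refl (EGF T n) (∑< n term) ⟩
        ∑< n term
      ∎)

  [1-x]EGF-avoidCount : ∀ r n → (EGF (avoidCount r) ⊛ (oneS ⊖ xS)) n ≡ (oneS ⊖ B ^S r) n
  [1-x]EGF-avoidCount zero    n = begin
    (EGF (avoidCount 0) ⊛ (oneS ⊖ xS)) n  ≡⟨ ⊛-[1-x] (EGF (avoidCount 0)) n ⟩
    Δ (EGF (avoidCount 0)) n              ≡⟨ Δ-cong (λ i → ℚ.0/n≡0 (i !) {{i ℕ.!≢0}}) n ⟩
    Δ (λ _ → 0ℚ) n                        ≡⟨ Δ-zero n ⟩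
    0ℚ                                    ≡⟨ ℚ.+-inverseʳ (oneS n) ⟨
    (oneS ⊖ B ^S 0) n                     ∎
    where
    Δ-zero : ∀ n → Δ (λ _ → 0ℚ) n ≡ 0ℚ
    Δ-zero zero    = refl
    Δ-zero (suc n) = refl
  [1-x]EGF-avoidCount (suc r) n = begin
    (E′ ⊛ (oneS ⊖ xS)) n                         ≡⟨ ⊛-[1-x] E′ n ⟩
    Δ E′ n                                       ≡⟨ Δ-cong (EGF-avoidCount-suc r) n ⟩
    Δ (expS ⊕ b ⊛ E) n                           ≡⟨ Δ-⊕ expS (b ⊛ E) n ⟩
    Δ expS n + Δ (b ⊛ E) n                       ≡⟨ cong (Δ expS n +_) (Δ-⊛ b E n) ⟩
    Δ expS n + (b ⊛ Δ E) n                       ≡⟨ cong (Δ expS n +_) (⊛-congʳ b induction n) ⟩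
    Δ expS n + (b ⊛ (oneS ⊖ B ^S r)) n           ≡⟨ cong (Δ expS n +_) (⊛-⊖ b oneS (B ^S r) n) ⟩
    Δ expS n + ((b ⊛ oneS) n - (b ⊛ B ^S r) n)   ≡⟨ cong₂ (λ x y → Δ expS n + (x - y)) (⊛-oneS b n) b⊛Bʳ≡B⊛Bʳ ⟩
    Δ expS n + (b n - (B ⊛ B ^S r) n)            ≡⟨ solve 3 (λ x y z → x :+ (y :- z) := (x :+ y) :- z) refl (Δ expS n) (b n) _ ⟩
    (Δ expS n + b n) - (B ⊛ B ^S r) n            ≡⟨ cong (_- (B ⊛ B ^S r) n) (Δexp+b≡1 n) ⟩
    (oneS ⊖ B ^S suc r) n                        ∎
    where
    E E′ : Series
    E  = EGF (avoidCount r)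
    E′ = EGF (avoidCount (suc r))
    b⊛Bʳ≡B⊛Bʳ : (b ⊛ B ^S r) n ≡ (B ⊛ B ^S r) n
    b⊛Bʳ≡B⊛Bʳ = ⊛-congˡ (B ^S r) (sym ∘ B≗b) n
    induction : ∀ i → Δ E i ≡ (oneS ⊖ B ^S r) i
    induction i = trans (sym (⊛-[1-x] E i)) ([1-x]EGF-avoidCount r i)

open import Data.Fin using (Fin; toℕ)
open import Data.Fin.Permutation using (↔⇒≡)
open import Data.List using (List; []; _∷_)
open import Data.Nat using (ℕ; suc; _+_; _*_; _≤_; _!)
open import Data.Nat.Properties using (_!≢0)
open import Data.Sum using (_⊎_)
open import Data.Vec using (Vec; lookup)
open import Function.Bundles using (_↔_)
open import Function.Properties.Inverse using (↔-sym; ↔-trans)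
open import Relation.Binary.PropositionalEquality using (_≡_; cong; module ≡-Reasoning)
open import Defs
open Counting using (avoidCount; nAvoiding; nAvoiding≡avoidCount)
open FirstLetter using (Avoiding↔Fin)
open Chains using (orientation; Avoiders↔Avoiding)
open PowerSeries using (B; frac; ⊛-congˡ; [1-x]EGF-avoidCount)

corollary18 : (m : ℕ) → 1 ≤ m →
    (chains : Vec (List ℕ) m) →
    (∀ (i : Fin m) →
      (lookup chains i ≡ suc (2 * toℕ i) ∷ (2 + 2 * toℕ i) ∷ [])
      ⊎ (lookup chains i ≡ (2 + 2 * toℕ i) ∷ suc (2 * toℕ i) ∷ [])) →
    (c : ℕ → ℕ) →
    (∀ n → Avoiders (PopLess chains {2 * m}) n ↔ Fin (c n)) →
    ∀ n → (EGF c ⊛ (oneS ⊖ xS)) n ≡ (oneS ⊖ (oneS ⊕ (xS ⊖ oneS) ⊛ expS) ^S m) n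
corollary18 m _ chains shape c avoiders↔c n = begin
  (EGF c ⊛ (oneS ⊖ xS)) n               ≡⟨ ⊛-congˡ (oneS ⊖ xS) (λ i → cong (λ k → frac k (i !) {{i !≢0}}) (c≡avoidCount i)) n ⟩
  (EGF (avoidCount m) ⊛ (oneS ⊖ xS)) n  ≡⟨ [1-x]EGF-avoidCount m n ⟩
  (oneS ⊖ B ^S m) n                     ∎
  where
  open ≡-Reasoning
  ori = orientation chains shape
  c≡avoidCount : ∀ n → c n ≡ avoidCount m n
  c≡avoidCount n = begin
    c n              ≡⟨ ↔⇒≡ (↔-trans (↔-sym (avoiders↔c n)) (↔-trans (Avoiders↔Avoiding chains shape n) (Avoiding↔Fin ori n))) ⟩
    nAvoiding ori n  ≡⟨ nAvoiding≡avoidCount ori n ⟩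
    avoidCount m n   ∎
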